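{- Let $n>k\geq m\geq 1$. Suppose $A$ is a $k$-subspace and $B$ is an $m$-subspace of $\mathbb{Z}_{p^s}^n$ with $B\nsubseteq A$. Then there is $U\in GL_n(\mathbb{Z}_{p^s})$ such that $$A=(0, I_k)U \quad\text{and}\quad B=(D, I_m)U,$$ where $D=\mathrm{diag}(p^{i_1}, \ldots, p^{i_r}, 0_{m-r, n-m-r})$ is an $m\times(n-m)$ matrix, $1\leq r\leq \min\{m, n-k\}$ and $0\leq i_1\leq \cdots \leq i_r\leq \max\{s-1, 1\}$.
   Context: $p$ is a prime, $s\ge1$, $R=\mathbb{Z}_{p^s}$; vectors are row vectors. A set $\{\alpha_1,\dots,\alpha_k\}\subseteq R^n$ is unimodular if the matrix with rows $\alpha_i$ has a right inverse over $R$. A $k$-subspace of $R^n$ is a submodule having a unimodular basis of $k$ vectors. A subspace is identified with a matrix representation (a matrix whose rows form such a basis); an equality like $A=(0,I_k)U$ means $A$ is the row space of the matrix $(0,I_k)U$. $\mathrm{diag}(\cdots)$ denotes a block-diagonal matrix, $0_{a,b}$ the $a\times b$ zero matrix. -}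

module Defs where

open import Data.Nat as ℕ using (ℕ; zero; suc; _<?_; _^_)
open import Data.Nat.Properties using () renaming (_≟_ to _≟ℕ_)
open import Data.Integer as ℤ using (ℤ; +_; 0ℤ; 1ℤ; _-_; _*_; _+_)
open import Data.Integer.Divisibility using (_∣_)
open import Data.Fin using (Fin; toℕ; fromℕ<) renaming (zero to fzero; suc to fsuc)
open import Data.Product using (Σ; ∃; _×_; _,_)
open import Relation.Nullary using (¬_; yes; no)

-- The ring R = ℤ_{p^s} is represented by ℤ with equality "congruent modulo p^s".
module Ring (p s : ℕ) where

  q : ℕ
  q = p ^ s

  infix 4 _≈_
  _≈_ : ℤ → ℤ → Set
  x ≈ y = (+ q) ∣ (x - y)

  Vector : ℕ → Set
  Vector n = Fin n → ℤ

  Matrix : ℕ → ℕ → Set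
  Matrix m n = Fin m → Fin n → ℤ

  sumF : ∀ n → (Fin n → ℤ) → ℤ
  sumF zero    f = 0ℤ
  sumF (suc n) f = f fzero + sumF n (λ i → f (fsuc i))

  infixl 7 _⊗_
  _⊗_ : ∀ {m l n} → Matrix m l → Matrix l n → Matrix m n
  (_⊗_ {l = l} A B) i j = sumF l (λ t → A i t * B t j)

  I : ∀ n → Matrix n n
  I n i j with toℕ i ≟ℕ toℕ j
  ... | yes _ = 1ℤ
  ... | no  _ = 0ℤ

  infix 4 _≋_
  _≋_ : ∀ {m n} → Matrix m n → Matrix m n → Set
  A ≋ B = ∀ i j → A i j ≈ B i j

  -- the rows of A (m×n) form a unimodular set: A has a right inverse over R
  Unimodular : ∀ {m n} → Matrix m n → Set
  Unimodular {m} {n} A = Σ (Matrix n m) λ X → A ⊗ X ≋ I m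

  GL : ∀ n → Matrix n n → Set
  GL n U = Σ (Matrix n n) λ V → (U ⊗ V ≋ I n) × (V ⊗ U ≋ I n)

  InRowSpace : ∀ {m n} → Matrix m n → Vector n → Set
  InRowSpace {m} {n} A v = Σ (Vector m) λ c → ∀ j → sumF m (λ i → c i * A i j) ≈ v j

  _⊑_ : ∀ {m m' n} → Matrix m n → Matrix m' n → Set
  A ⊑ B = ∀ v → InRowSpace A v → InRowSpace B v

  -- equality of row spaces ("A = M" for a subspace A and a matrix representation M)
  _≐_ : ∀ {m m' n} → Matrix m n → Matrix m' n → Set
  A ≐ B = (A ⊑ B) × (B ⊑ A)

  -- the k×n matrix (0_{k,n-k}, I_k)
  ZeroI : ∀ n k → Matrix k n
  ZeroI n k i j with toℕ j ≟ℕ (n ℕ.∸ k) ℕ.+ toℕ i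
  ... | yes _ = 1ℤ
  ... | no  _ = 0ℤ

  -- entry (i,j) of D = diag(p^{e 0}, …, p^{e (r-1)}, 0_{m-r, n-m-r})
  Dentry : (r : ℕ) → (Fin r → ℕ) → ℕ → ℕ → ℤ
  Dentry r e i j with i ≟ℕ j | i <? r
  ... | yes _ | yes i<r = + (p ^ e (fromℕ< i<r))
  ... | yes _ | no  _   = 0ℤ
  ... | no  _ | _       = 0ℤ

  -- the m×n matrix (D, I_m), D being m×(n-m)
  DI : ∀ n m r → (Fin r → ℕ) → Matrix m n
  DI n m r e i j with toℕ j <? n ℕ.∸ m
  ... | yes _ = Dentry r e (toℕ i) (toℕ j)
  ... | no  _ with toℕ j ≟ℕ (n ℕ.∸ m) ℕ.+ toℕ i
  ...   | yes _ = 1ℤ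
  ...   | no  _ = 0ℤ

-- Over ℤ/p^s every matrix has a Smith form L M R = diag(p^e₁, …, p^e_r, 0) with e₁ ≤ … ≤ e_r < s,
-- obtained by repeatedly pivoting on an entry of least p-adic valuation. If M has a right inverse
-- modulo p, all its Smith exponents are 0 and M has full rank, so invertible column operations
-- bring M to (0, I); for A this gives A = (0, I_k) W₁⁻¹. Write B W₁ = (B₁, B₂) and put B₁ in Smith
-- form D. The first t rows of D carry unit pivots, which clear the corresponding rows of the second
-- block; the remaining rows of D vanish modulo p, so the remaining rows of the second block are right
-- invertible modulo p and reduce to (0, I) as well. Both steps are block upper triangular column
-- operations, so A keeps the form (0, I_k) while B becomes (D, I_m). Finally r ≥ 1, since for r = 0
-- the rows of (0, I_m) U lie in the row space of (0, I_k) U, i.e. B ⊆ A.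

module Submission where

open import Defs
open import Data.Nat using (ℕ; _≤_; _<_; _∸_; _⊔_)
open import Data.Nat.Primality using (Prime)
open import Data.Fin using (Fin) renaming (_≤_ to _≤ᶠ_)
open import Data.Product using (Σ; _×_)
open import Relation.Nullary using (¬_)

open import Data.Nat as ℕ using (zero; suc; z≤n; s≤s; _^_; _<?_)
import Data.Nat.Properties as ℕP
import Data.Nat.Divisibility as ℕD
open import Data.Nat.Base using (nonTrivial⇒≢1)
open import Data.Nat.Coprimality using (Coprime; coprime-divisor; coprime-Bézout)
open import Data.Nat.GCD using (module Bézout)
open import Data.Nat.Primality using (prime⇒irreducible; prime⇒nonTrivial)
open import Data.Integer using (ℤ; +_; -[1+_]; 0ℤ; 1ℤ; _+_; _-_; _*_; -_)
import Data.Integer.Properties as ℤP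
import Data.Integer.Divisibility.Signed as ℤD
open import Data.Integer.Tactic.RingSolver using (solve-∀)
open import Data.Fin using (toℕ; fromℕ<; splitAt; join; cast; _↑ˡ_; _↑ʳ_)
  renaming (zero to fzero; suc to fsuc)
import Data.Fin.Properties as FinP
open import Data.Fin.Permutation.Components using (transpose; transpose-inverse)
open import Data.Product using (∃-syntax; _,_; proj₁; proj₂)
open import Data.Sum as Sum using (inj₁; inj₂; [_,_]′)
import Data.Sum.Properties as SumP
open import Data.Empty using (⊥-elim)
open import Relation.Nullary using (Dec; yes; no)
import Relation.Nullary.Decidable as Dec
open import Relation.Binary.Bundles using (Setoid)
open import Relation.Binary.PropositionalEquality
import Relation.Binary.Reasoning.Setoid as SetoidReasoning
open import Function using (_∘_)

module NormalForm (p s : ℕ) where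

  open Ring p s

  qℤ : ℤ
  qℤ = + q

  -- Congruence modulo q (the _≈_ of Defs), wrapped in a record so that Agda can infer both sides.
  infix 4 _≃_
  record _≃_ (x y : ℤ) : Set where
    constructor ⟨_⟩
    field unwrap : x ≈ y
  open _≃_

  ≡+*q⇒≃ : ∀ {x y} t → x ≡ y + t * qℤ → x ≃ y
  ≡+*q⇒≃ {x} {y} t refl = ⟨ ℤD.∣⇒∣ᵤ (ℤD.divides t (shift y t qℤ)) ⟩
    where
    shift : ∀ y t q → (y + t * q) - y ≡ t * q
    shift = solve-∀

  ≃⇒≡+*q : ∀ {x y} → x ≃ y → ∃[ t ] x ≡ y + t * qℤ
  ≃⇒≡+*q {x} {y} ⟨ x≈y ⟩ with ℤD.∣ᵤ⇒∣ x≈y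
  ... | ℤD.divides t x-y≡t*q = t , trans (unshift x y) (cong (_+_ y) x-y≡t*q)
    where
    unshift : ∀ x y → x ≡ y + (x - y)
    unshift = solve-∀

  ≃-reflexive : ∀ {x y} → x ≡ y → x ≃ y
  ≃-reflexive {x} refl = ≡+*q⇒≃ 0ℤ (sym (trans (cong (_+_ x) (ℤP.*-zeroˡ qℤ)) (ℤP.+-identityʳ x)))

  ≃-refl : ∀ {x} → x ≃ x
  ≃-refl = ≃-reflexive refl

  ≃-sym : ∀ {x y} → x ≃ y → y ≃ x
  ≃-sym {y = y} x≃y with ≃⇒≡+*q x≃y
  ... | t , refl = ≡+*q⇒≃ (- t) (undo y t qℤ)
    where
    undo : ∀ y t q → y ≡ (y + t * q) + (- t) * q
    undo = solve-∀

  ≃-trans : ∀ {x y z} → x ≃ y → y ≃ z → x ≃ z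
  ≃-trans {z = z} x≃y y≃z with ≃⇒≡+*q x≃y | ≃⇒≡+*q y≃z
  ... | t , refl | u , refl = ≡+*q⇒≃ (u + t) (collect z t u qℤ)
    where
    collect : ∀ z t u q → (z + u * q) + t * q ≡ z + (u + t) * q
    collect = solve-∀

  +-cong : ∀ {x x′ y y′} → x ≃ x′ → y ≃ y′ → x + y ≃ x′ + y′
  +-cong {x′ = x′} {y′ = y′} x≃x′ y≃y′ with ≃⇒≡+*q x≃x′ | ≃⇒≡+*q y≃y′
  ... | t , refl | u , refl = ≡+*q⇒≃ (t + u) (collect x′ y′ t u qℤ)
    where
    collect : ∀ x y t u q → (x + t * q) + (y + u * q) ≡ (x + y) + (t + u) * q
    collect = solve-∀

  *-cong : ∀ {x x′ y y′} → x ≃ x′ → y ≃ y′ → x * y ≃ x′ * y′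
  *-cong {x′ = x′} {y′ = y′} x≃x′ y≃y′ with ≃⇒≡+*q x≃x′ | ≃⇒≡+*q y≃y′
  ... | t , refl | u , refl = ≡+*q⇒≃ (t * y′ + x′ * u + t * u * qℤ) (expand x′ y′ t u qℤ)
    where
    expand : ∀ x y t u q → (x + t * q) * (y + u * q) ≡ x * y + (t * y + x * u + t * u * q) * q
    expand = solve-∀

  -‿cong : ∀ {x x′} → x ≃ x′ → - x ≃ - x′
  -‿cong {x′ = x′} x≃x′ with ≃⇒≡+*q x≃x′
  ... | t , refl = ≡+*q⇒≃ (- t) (negate x′ t qℤ)
    where
    negate : ∀ x t q → - (x + t * q) ≡ - x + (- t) * q
    negate = solve-∀

  ≃-setoid : Setoid _ _
  ≃-setoid = record
    { Carrier = ℤ ; _≈_ = _≃_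
    ; isEquivalence = record { refl = ≃-refl ; sym = ≃-sym ; trans = ≃-trans } }

  sumF-cong : ∀ n {f g : Fin n → ℤ} → (∀ i → f i ≡ g i) → sumF n f ≡ sumF n g
  sumF-cong zero    f≗g = refl
  sumF-cong (suc n) f≗g = cong₂ _+_ (f≗g fzero) (sumF-cong n (f≗g ∘ fsuc))

  sumF-cong-≃ : ∀ n {f g : Fin n → ℤ} → (∀ i → f i ≃ g i) → sumF n f ≃ sumF n g
  sumF-cong-≃ zero    f≃g = ≃-refl
  sumF-cong-≃ (suc n) f≃g = +-cong (f≃g fzero) (sumF-cong-≃ n (f≃g ∘ fsuc))

  sumF-zero : ∀ n {f : Fin n → ℤ} → (∀ i → f i ≡ 0ℤ) → sumF n f ≡ 0ℤ
  sumF-zero zero    f≗0 = refl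
  sumF-zero (suc n) f≗0 = cong₂ _+_ (f≗0 fzero) (sumF-zero n (f≗0 ∘ fsuc))

  sumF-distrib-+ : ∀ n (f g : Fin n → ℤ) → sumF n (λ i → f i + g i) ≡ sumF n f + sumF n g
  sumF-distrib-+ zero    f g = refl
  sumF-distrib-+ (suc n) f g =
    trans (cong (_+_ (f fzero + g fzero)) (sumF-distrib-+ n (f ∘ fsuc) (g ∘ fsuc)))
          (interchange (f fzero) (g fzero) _ _)
    where
    interchange : ∀ a b c d → (a + b) + (c + d) ≡ (a + c) + (b + d)
    interchange = solve-∀

  sumF-*ˡ : ∀ n c (f : Fin n → ℤ) → sumF n (λ i → c * f i) ≡ c * sumF n f
  sumF-*ˡ zero    c f = sym (ℤP.*-zeroʳ c)
  sumF-*ˡ (suc n) c f =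
    trans (cong (_+_ (c * f fzero)) (sumF-*ˡ n c (f ∘ fsuc))) (sym (ℤP.*-distribˡ-+ c (f fzero) _))

  sumF-*ʳ : ∀ n c (f : Fin n → ℤ) → sumF n (λ i → f i * c) ≡ sumF n f * c
  sumF-*ʳ zero    c f = sym (ℤP.*-zeroˡ c)
  sumF-*ʳ (suc n) c f =
    trans (cong (_+_ (f fzero * c)) (sumF-*ʳ n c (f ∘ fsuc))) (sym (ℤP.*-distribʳ-+ c (f fzero) _))

  sumF-neg : ∀ n (f : Fin n → ℤ) → sumF n (λ i → - f i) ≡ - sumF n f
  sumF-neg zero    f = refl
  sumF-neg (suc n) f =
    trans (cong (_+_ (- f fzero)) (sumF-neg n (f ∘ fsuc))) (sym (ℤP.neg-distrib-+ (f fzero) _))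

  sumF-comm : ∀ m n (f : Fin m → Fin n → ℤ) →
    sumF m (λ i → sumF n (f i)) ≡ sumF n (λ j → sumF m (λ i → f i j))
  sumF-comm zero    n f = sym (sumF-zero n (λ _ → refl))
  sumF-comm (suc m) n f =
    trans (cong (_+_ (sumF n (f fzero))) (sumF-comm m n (f ∘ fsuc)))
          (sym (sumF-distrib-+ n (f fzero) _))

  sumF-splitAt : ∀ x y (f : Fin (x ℕ.+ y) → ℤ) →
    sumF (x ℕ.+ y) f ≡ sumF x (λ i → f (i ↑ˡ y)) + sumF y (λ j → f (x ↑ʳ j))
  sumF-splitAt zero    y f = sym (ℤP.+-identityˡ _)
  sumF-splitAt (suc x) y f =
    trans (cong (_+_ (f fzero)) (sumF-splitAt x y (f ∘ fsuc))) (sym (ℤP.+-assoc (f fzero) _ _))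

  sumF-single : ∀ n (f : Fin n → ℤ) v (v<n : v ℕ.< n) →
    (∀ i → toℕ i ≢ v → f i ≡ 0ℤ) → sumF n f ≡ f (fromℕ< v<n)
  sumF-single (suc n) f zero    v<n f≗0 =
    trans (cong (_+_ (f fzero)) (sumF-zero n (λ i → f≗0 (fsuc i) λ ()))) (ℤP.+-identityʳ _)
  sumF-single (suc n) f (suc v) v<n f≗0 =
    trans (cong (_+ sumF n (f ∘ fsuc)) (f≗0 fzero λ ()))
    (trans (ℤP.+-identityˡ _)
           (sumF-single n (f ∘ fsuc) v (ℕ.s<s⁻¹ v<n) (λ i i≢v → f≗0 (fsuc i) (i≢v ∘ ℕP.suc-injective))))

  sumF-singleᶠ : ∀ n (f : Fin n → ℤ) c → (∀ i → i ≢ c → f i ≡ 0ℤ) → sumF n f ≡ f c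
  sumF-singleᶠ n f c f≗0 =
    trans (sumF-single n f (toℕ c) (FinP.toℕ<n c) (λ i i≢c → f≗0 i (i≢c ∘ cong toℕ)))
          (cong f (FinP.fromℕ<-toℕ c _))

  infix 4 _≃ₘ_
  _≃ₘ_ : ∀ {m n} → Matrix m n → Matrix m n → Set
  A ≃ₘ B = ∀ i j → A i j ≃ B i j

  ≡⇒≃ₘ : ∀ {m n} {A B : Matrix m n} → (∀ i j → A i j ≡ B i j) → A ≃ₘ B
  ≡⇒≃ₘ A≡B i j = ≃-reflexive (A≡B i j)

  ≃ₘ-refl : ∀ {m n} {A : Matrix m n} → A ≃ₘ A
  ≃ₘ-refl i j = ≃-refl

  ≃ₘ-sym : ∀ {m n} {A B : Matrix m n} → A ≃ₘ B → B ≃ₘ A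
  ≃ₘ-sym A≃B i j = ≃-sym (A≃B i j)

  ≃ₘ-trans : ∀ {m n} {A B C : Matrix m n} → A ≃ₘ B → B ≃ₘ C → A ≃ₘ C
  ≃ₘ-trans A≃B B≃C i j = ≃-trans (A≃B i j) (B≃C i j)

  ≃ₘ-setoid : ℕ → ℕ → Setoid _ _
  ≃ₘ-setoid m n = record
    { Carrier = Matrix m n ; _≈_ = _≃ₘ_
    ; isEquivalence = record { refl = ≃ₘ-refl ; sym = ≃ₘ-sym ; trans = ≃ₘ-trans } }

  𝟘 : ∀ {m n} → Matrix m n
  𝟘 i j = 0ℤ

  infixl 6 _⊕_
  _⊕_ : ∀ {m n} → Matrix m n → Matrix m n → Matrix m n
  (A ⊕ B) i j = A i j + B i j

  ⊖_ : ∀ {m n} → Matrix m n → Matrix m n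
  (⊖ A) i j = - A i j

  infixl 7 _·ₘ_
  _·ₘ_ : ∀ {m n} → ℤ → Matrix m n → Matrix m n
  (c ·ₘ A) i j = c * A i j

  ⊗-cong : ∀ {m l n} {A A′ : Matrix m l} {B B′ : Matrix l n} → A ≃ₘ A′ → B ≃ₘ B′ → A ⊗ B ≃ₘ A′ ⊗ B′
  ⊗-cong {l = l} A≃A′ B≃B′ i j = sumF-cong-≃ l (λ t → *-cong (A≃A′ i t) (B≃B′ t j))

  ⊗-congˡ : ∀ {m l n} {A A′ : Matrix m l} (B : Matrix l n) → A ≃ₘ A′ → A ⊗ B ≃ₘ A′ ⊗ B
  ⊗-congˡ B A≃A′ = ⊗-cong A≃A′ (≃ₘ-refl {A = B})

  ⊗-congʳ : ∀ {m l n} (A : Matrix m l) {B B′ : Matrix l n} → B ≃ₘ B′ → A ⊗ B ≃ₘ A ⊗ B′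
  ⊗-congʳ A B≃B′ = ⊗-cong (≃ₘ-refl {A = A}) B≃B′

  ⊕-cong : ∀ {m n} {A A′ B B′ : Matrix m n} → A ≃ₘ A′ → B ≃ₘ B′ → A ⊕ B ≃ₘ A′ ⊕ B′
  ⊕-cong A≃A′ B≃B′ i j = +-cong (A≃A′ i j) (B≃B′ i j)

  ⊖-cong : ∀ {m n} {A B : Matrix m n} → A ≃ₘ B → ⊖ A ≃ₘ ⊖ B
  ⊖-cong A≃B i j = -‿cong (A≃B i j)

  ⊗-assoc : ∀ {m l o n} (A : Matrix m l) (B : Matrix l o) (C : Matrix o n) →
    (A ⊗ B) ⊗ C ≃ₘ A ⊗ (B ⊗ C)
  ⊗-assoc {l = l} {o} A B C = ≡⇒≃ₘ λ i j → begin
      sumF o (λ t → sumF l (λ u → A i u * B u t) * C t j)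
    ≡⟨ sumF-cong o (λ t → sym (sumF-*ʳ l (C t j) (λ u → A i u * B u t))) ⟩
      sumF o (λ t → sumF l (λ u → A i u * B u t * C t j))
    ≡⟨ sumF-comm o l _ ⟩
      sumF l (λ u → sumF o (λ t → A i u * B u t * C t j))
    ≡⟨ sumF-cong l (λ u → trans (sumF-cong o (λ t → ℤP.*-assoc (A i u) (B u t) (C t j)))
                                (sumF-*ˡ o (A i u) _)) ⟩
      sumF l (λ u → A i u * sumF o (λ t → B u t * C t j)) ∎
    where open ≡-Reasoning

  δ : ℕ → ℕ → ℤ
  δ a b with a ℕP.≟ b
  ... | yes _ = 1ℤ
  ... | no  _ = 0ℤ

  δ-refl : ∀ a → δ a a ≡ 1ℤ
  δ-refl a with a ℕP.≟ a
  ... | yes _   = refl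
  ... | no  a≢a = ⊥-elim (a≢a refl)

  δ-off : ∀ {a b} → a ≢ b → δ a b ≡ 0ℤ
  δ-off {a} {b} a≢b with a ℕP.≟ b
  ... | yes a≡b = ⊥-elim (a≢b a≡b)
  ... | no  _   = refl

  δ-+ : ∀ c a b → δ (c ℕ.+ a) (c ℕ.+ b) ≡ δ a b
  δ-+ c a b with a ℕP.≟ b
  ... | yes refl = δ-refl (c ℕ.+ a)
  ... | no  a≢b  = δ-off (a≢b ∘ ℕP.+-cancelˡ-≡ c a b)

  I-δ : ∀ n (i j : Fin n) → I n i j ≡ δ (toℕ j) (toℕ i)
  I-δ n i j with toℕ i ℕP.≟ toℕ j
  ... | yes i≡j = sym (trans (cong (δ (toℕ j)) i≡j) (δ-refl (toℕ j)))
  ... | no  i≢j = sym (δ-off (i≢j ∘ sym))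

  I-diag : ∀ n (i : Fin n) → I n i i ≡ 1ℤ
  I-diag n i = trans (I-δ n i i) (δ-refl (toℕ i))

  I-offᴺ : ∀ n (i j : Fin n) → toℕ i ≢ toℕ j → I n i j ≡ 0ℤ
  I-offᴺ n i j i≢j = trans (I-δ n i j) (δ-off (i≢j ∘ sym))

  I-off : ∀ n (i j : Fin n) → i ≢ j → I n i j ≡ 0ℤ
  I-off n i j i≢j = I-offᴺ n i j (i≢j ∘ FinP.toℕ-injective)

  I-shifted : ∀ {N N′} (i j : Fin N) (i′ j′ : Fin N′) c → toℕ i ≡ c ℕ.+ toℕ i′ → toℕ j ≡ c ℕ.+ toℕ j′ →
    I N i j ≡ I N′ i′ j′
  I-shifted i j i′ j′ c i≡c+i′ j≡c+j′ =
    trans (I-δ _ i j) (trans (cong₂ δ j≡c+j′ i≡c+i′) (trans (δ-+ c (toℕ j′) (toℕ i′)) (sym (I-δ _ i′ j′))))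

  ⊗-identityˡ′ : ∀ {m n} (A : Matrix m n) i j → (I m ⊗ A) i j ≡ A i j
  ⊗-identityˡ′ {m} A i j =
    trans (sumF-singleᶠ m _ i (λ t t≢i → trans (cong (_* A t j) (I-off m i t (t≢i ∘ sym))) (ℤP.*-zeroˡ (A t j))))
          (trans (cong (_* A i j) (I-diag m i)) (ℤP.*-identityˡ (A i j)))

  ⊗-identityʳ′ : ∀ {m n} (A : Matrix m n) i j → (A ⊗ I n) i j ≡ A i j
  ⊗-identityʳ′ {n = n} A i j =
    trans (sumF-singleᶠ n _ j (λ t t≢j → trans (cong (A i t *_) (I-off n t j t≢j)) (ℤP.*-zeroʳ (A i t))))
          (trans (cong (A i j *_) (I-diag n j)) (ℤP.*-identityʳ (A i j)))

  ⊗-identityˡ : ∀ {m n} (A : Matrix m n) → I m ⊗ A ≃ₘ A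
  ⊗-identityˡ A = ≡⇒≃ₘ (⊗-identityˡ′ A)

  ⊗-identityʳ : ∀ {m n} (A : Matrix m n) → A ⊗ I n ≃ₘ A
  ⊗-identityʳ A = ≡⇒≃ₘ (⊗-identityʳ′ A)

  ⊗-zeroˡ : ∀ {m l n} (A : Matrix l n) → 𝟘 {m} ⊗ A ≃ₘ 𝟘
  ⊗-zeroˡ {l = l} A = ≡⇒≃ₘ λ i j → sumF-zero l (λ t → ℤP.*-zeroˡ (A t j))

  ⊗-zeroʳ : ∀ {m l n} (A : Matrix m l) → A ⊗ 𝟘 {l} {n} ≃ₘ 𝟘
  ⊗-zeroʳ {l = l} A = ≡⇒≃ₘ λ i j → sumF-zero l (λ t → ℤP.*-zeroʳ (A i t))

  ⊗-distribˡ-⊕ : ∀ {m l n} (A : Matrix m l) (B C : Matrix l n) → A ⊗ (B ⊕ C) ≃ₘ A ⊗ B ⊕ A ⊗ C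
  ⊗-distribˡ-⊕ {l = l} A B C = ≡⇒≃ₘ λ i j →
    trans (sumF-cong l (λ t → ℤP.*-distribˡ-+ (A i t) (B t j) (C t j))) (sumF-distrib-+ l _ _)

  ⊗-distribʳ-⊕ : ∀ {m l n} (A : Matrix l n) (B C : Matrix m l) → (B ⊕ C) ⊗ A ≃ₘ B ⊗ A ⊕ C ⊗ A
  ⊗-distribʳ-⊕ {l = l} A B C = ≡⇒≃ₘ λ i j →
    trans (sumF-cong l (λ t → ℤP.*-distribʳ-+ (A t j) (B i t) (C i t))) (sumF-distrib-+ l _ _)

  ⊖-distribˡ-⊗ : ∀ {m l n} (A : Matrix m l) (B : Matrix l n) → (⊖ A) ⊗ B ≃ₘ ⊖ (A ⊗ B)
  ⊖-distribˡ-⊗ {l = l} A B = ≡⇒≃ₘ λ i j →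
    trans (sumF-cong l (λ t → sym (ℤP.neg-distribˡ-* (A i t) (B t j)))) (sumF-neg l _)

  ⊖-distribʳ-⊗ : ∀ {m l n} (A : Matrix m l) (B : Matrix l n) → A ⊗ (⊖ B) ≃ₘ ⊖ (A ⊗ B)
  ⊖-distribʳ-⊗ {l = l} A B = ≡⇒≃ₘ λ i j →
    trans (sumF-cong l (λ t → sym (ℤP.neg-distribʳ-* (A i t) (B t j)))) (sumF-neg l _)

  ·ₘ-assoc-⊗ : ∀ {m l n} c (A : Matrix m l) (B : Matrix l n) → (c ·ₘ A) ⊗ B ≃ₘ c ·ₘ (A ⊗ B)
  ·ₘ-assoc-⊗ {l = l} c A B = ≡⇒≃ₘ λ i j →
    trans (sumF-cong l (λ t → ℤP.*-assoc c (A i t) (B t j))) (sumF-*ˡ l c _)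

  ⊗-·ₘ-comm : ∀ {m l n} (A : Matrix m l) c (B : Matrix l n) → A ⊗ (c ·ₘ B) ≃ₘ c ·ₘ (A ⊗ B)
  ⊗-·ₘ-comm {l = l} A c B = ≡⇒≃ₘ λ i j →
    trans (sumF-cong l (λ t → swap (A i t) c (B t j))) (sumF-*ˡ l c _)
    where
    swap : ∀ a c b → a * (c * b) ≡ c * (a * b)
    swap = solve-∀

  ⊕-identityˡ : ∀ {m n} (A : Matrix m n) → 𝟘 ⊕ A ≃ₘ A
  ⊕-identityˡ A = ≡⇒≃ₘ λ i j → ℤP.+-identityˡ (A i j)

  ⊕-identityʳ : ∀ {m n} (A : Matrix m n) → A ⊕ 𝟘 ≃ₘ A
  ⊕-identityʳ A = ≡⇒≃ₘ λ i j → ℤP.+-identityʳ (A i j)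

  ⊕-inverseˡ : ∀ {m n} (A : Matrix m n) → (⊖ A) ⊕ A ≃ₘ 𝟘
  ⊕-inverseˡ A = ≡⇒≃ₘ λ i j → ℤP.+-inverseˡ (A i j)

  ⊕-inverseʳ : ∀ {m n} (A : Matrix m n) → A ⊕ (⊖ A) ≃ₘ 𝟘
  ⊕-inverseʳ A = ≡⇒≃ₘ λ i j → ℤP.+-inverseʳ (A i j)

  record Invertible (n : ℕ) (U : Matrix n n) : Set where
    constructor invertible
    field
      inverse  : Matrix n n
      inverseʳ : U ⊗ inverse ≃ₘ I n
      inverseˡ : inverse ⊗ U ≃ₘ I n
  open Invertible

  Invertible⇒GL : ∀ {n U} → Invertible n U → GL n U
  Invertible⇒GL (invertible V UV≃I VU≃I) = V , (λ i j → unwrap (UV≃I i j)) , (λ i j → unwrap (VU≃I i j))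

  I-invertible : ∀ n → Invertible n (I n)
  I-invertible n = invertible (I n) (⊗-identityˡ (I n)) (⊗-identityˡ (I n))

  inverse-invertible : ∀ {n U} (U-inv : Invertible n U) → Invertible n (inverse U-inv)
  inverse-invertible (invertible V UV≃I VU≃I) = invertible _ VU≃I UV≃I

  cancelˡ : ∀ {m n} (U V : Matrix m m) (A : Matrix m n) → U ⊗ V ≃ₘ I m → U ⊗ (V ⊗ A) ≃ₘ A
  cancelˡ U V A UV≃I =
    ≃ₘ-trans (≃ₘ-sym (⊗-assoc U V A)) (≃ₘ-trans (⊗-congˡ A UV≃I) (⊗-identityˡ A))

  cancelʳ : ∀ {m n} (A : Matrix m n) (U V : Matrix n n) → U ⊗ V ≃ₘ I n → (A ⊗ U) ⊗ V ≃ₘ A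
  cancelʳ A U V UV≃I = ≃ₘ-trans (⊗-assoc A U V) (≃ₘ-trans (⊗-congʳ A UV≃I) (⊗-identityʳ A))

  ⊗-invertible : ∀ {n U V} → Invertible n U → Invertible n V → Invertible n (U ⊗ V)
  ⊗-invertible {U = U} {V} (invertible U′ UU′ U′U) (invertible V′ VV′ V′V) = invertible (V′ ⊗ U′)
    (≃ₘ-trans (⊗-assoc U V (V′ ⊗ U′)) (≃ₘ-trans (⊗-congʳ U (cancelˡ V V′ U′ VV′)) UU′))
    (≃ₘ-trans (⊗-assoc V′ U′ (U ⊗ V)) (≃ₘ-trans (⊗-congʳ V′ (cancelˡ U′ U V U′U)) V′V))

  factor⇒⊑ : ∀ {m m′ n} (X : Matrix m n) (Y : Matrix m′ n) (C : Matrix m m′) → X ≃ₘ C ⊗ Y → X ⊑ Y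
  factor⇒⊑ {m} {m′} X Y C X≃CY v (c , cX≈v) = cC , λ j → unwrap (begin
      sumF m′ (λ l → cC l * Y l j)
    ≈⟨ ⊗-assoc {m = 1} (λ _ → c) C Y fzero j ⟩
      sumF m (λ i → c i * (C ⊗ Y) i j)
    ≈⟨ sumF-cong-≃ m (λ i → *-cong (≃-refl {c i}) (≃-sym (X≃CY i j))) ⟩
      sumF m (λ i → c i * X i j)
    ≈⟨ ⟨ cX≈v j ⟩ ⟩
      v j ∎)
    where
    open SetoidReasoning ≃-setoid
    cC : Vector m′
    cC = ((λ (_ : Fin 1) → c) ⊗ C) fzero

  ⊑-trans : ∀ {m m′ m″ n} {X : Matrix m n} {Y : Matrix m′ n} {Z : Matrix m″ n} → X ⊑ Y → Y ⊑ Z → X ⊑ Z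
  ⊑-trans X⊑Y Y⊑Z v v∈X = Y⊑Z v (X⊑Y v v∈X)

  equivalent⇒≐ : ∀ {m n} (X Y : Matrix m n) {P : Matrix m m} {W : Matrix n n}
    (P-inv : Invertible m P) (W-inv : Invertible n W) →
    (P ⊗ X) ⊗ W ≃ₘ Y → X ≐ (Y ⊗ inverse W-inv)
  equivalent⇒≐ X Y {P} {W} (invertible P′ PP′ P′P) (invertible W′ WW′ W′W) PXW≃Y =
    factor⇒⊑ X (Y ⊗ W′) P′ X≃P′YW′ , factor⇒⊑ (Y ⊗ W′) X P YW′≃PX
    where
    YW′≃PX : Y ⊗ W′ ≃ₘ P ⊗ X
    YW′≃PX = ≃ₘ-trans (⊗-congˡ W′ (≃ₘ-sym PXW≃Y)) (cancelʳ (P ⊗ X) W W′ WW′)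
    X≃P′YW′ : X ≃ₘ P′ ⊗ (Y ⊗ W′)
    X≃P′YW′ = ≃ₘ-trans (≃ₘ-sym (cancelˡ P′ P X P′P)) (⊗-congʳ P′ (≃ₘ-sym YW′≃PX))

  corner : ∀ {m n} → ℤ → Matrix m n → Matrix (suc m) (suc n)
  corner x A fzero    fzero    = x
  corner x A fzero    (fsuc j) = 0ℤ
  corner x A (fsuc i) fzero    = 0ℤ
  corner x A (fsuc i) (fsuc j) = A i j

  corner-⊗ : ∀ {m l n} x y (A : Matrix m l) (B : Matrix l n) → corner x A ⊗ corner y B ≃ₘ corner (x * y) (A ⊗ B)
  corner-⊗ {l = l} x y A B = ≡⇒≃ₘ λ where
    fzero    fzero    → trans (cong (_+_ (x * y)) (sumF-zero l (λ _ → refl))) (ℤP.+-identityʳ _)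
    fzero    (fsuc j) → cong₂ _+_ (ℤP.*-zeroʳ x) (sumF-zero l (λ t → ℤP.*-zeroˡ (B t j)))
    (fsuc i) fzero    → cong₂ _+_ (ℤP.*-zeroˡ y) (sumF-zero l (λ t → ℤP.*-zeroʳ (A i t)))
    (fsuc i) (fsuc j) → ℤP.+-identityˡ _

  corner-cong : ∀ {m n} {x y} {A B : Matrix m n} → x ≃ y → A ≃ₘ B → corner x A ≃ₘ corner y B
  corner-cong x≃y A≃B fzero    fzero    = x≃y
  corner-cong x≃y A≃B fzero    (fsuc j) = ≃-refl
  corner-cong x≃y A≃B (fsuc i) fzero    = ≃-refl
  corner-cong x≃y A≃B (fsuc i) (fsuc j) = A≃B i j

  I-suc : ∀ n → I (suc n) ≃ₘ corner 1ℤ (I n)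
  I-suc n = ≡⇒≃ₘ λ where
    fzero    fzero    → refl
    fzero    (fsuc j) → I-offᴺ (suc n) fzero (fsuc j) λ ()
    (fsuc i) fzero    → I-offᴺ (suc n) (fsuc i) fzero λ ()
    (fsuc i) (fsuc j) → I-shifted (fsuc i) (fsuc j) i j 1 refl refl

  corner-invertible : ∀ {n} {A : Matrix n n} x y → x * y ≃ 1ℤ → y * x ≃ 1ℤ →
    Invertible n A → Invertible (suc n) (corner x A)
  corner-invertible {n} {A} x y xy≃1 yx≃1 (invertible A′ AA′ A′A) = invertible (corner y A′)
    (≃ₘ-trans (corner-⊗ x y A A′) (≃ₘ-trans (corner-cong xy≃1 AA′) (≃ₘ-sym (I-suc n))))
    (≃ₘ-trans (corner-⊗ y x A′ A) (≃ₘ-trans (corner-cong yx≃1 A′A) (≃ₘ-sym (I-suc n))))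

  corner-1-invertible : ∀ {n} {A : Matrix n n} → Invertible n A → Invertible (suc n) (corner 1ℤ A)
  corner-1-invertible = corner-invertible 1ℤ 1ℤ ≃-refl ≃-refl

  perm : ∀ {n} → (Fin n → Fin n) → Matrix n n
  perm {n} σ i j = I n (σ i) j

  perm-⊗ : ∀ {n k} (σ : Fin n → Fin n) (M : Matrix n k) → perm σ ⊗ M ≃ₘ λ i j → M (σ i) j
  perm-⊗ σ M i j = ⊗-identityˡ M (σ i) j

  ⊗-perm : ∀ {m n} {σ τ : Fin n → Fin n} → (∀ i → τ (σ i) ≡ i) → (∀ i → σ (τ i) ≡ i) →
    (M : Matrix m n) → M ⊗ perm σ ≃ₘ λ i j → M i (τ j)
  ⊗-perm {n = n} {σ} {τ} τσ≗id στ≗id M = ≡⇒≃ₘ λ i j →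
    trans (sumF-singleᶠ n _ (τ j) λ t t≢τj →
             trans (cong (M i t *_) (I-off n (σ t) j λ σt≡j → t≢τj (trans (sym (τσ≗id t)) (cong τ σt≡j))))
                   (ℤP.*-zeroʳ (M i t)))
          (trans (cong (λ k → M i (τ j) * I n k j) (στ≗id j))
                 (trans (cong (M i (τ j) *_) (I-diag n j)) (ℤP.*-identityʳ _)))

  perm-invertible : ∀ {n} {σ τ : Fin n → Fin n} → (∀ i → τ (σ i) ≡ i) → (∀ i → σ (τ i) ≡ i) →
    Invertible n (perm σ)
  perm-invertible {n} {σ} {τ} τσ≗id στ≗id = invertible (perm τ)
    (≃ₘ-trans (perm-⊗ σ (perm τ)) (≡⇒≃ₘ λ i j → cong (λ k → I n k j) (τσ≗id i)))
    (≃ₘ-trans (perm-⊗ τ (perm σ)) (≡⇒≃ₘ λ i j → cong (λ k → I n k j) (στ≗id i)))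

  transpose-invertible : ∀ {n} (i j : Fin n) → Invertible n (perm (transpose i j))
  transpose-invertible i j =
    perm-invertible {τ = transpose j i} (λ _ → transpose-inverse j i) (λ _ → transpose-inverse i j)

  e₀ : ∀ {n} → Fin (suc n) → ℤ
  e₀ fzero    = 1ℤ
  e₀ (fsuc _) = 0ℤ

  I-row₀ : ∀ n j → I (suc n) fzero j ≡ e₀ j
  I-row₀ n fzero    = refl
  I-row₀ n (fsuc j) = I-offᴺ (suc n) fzero (fsuc j) λ ()

  I-col₀ : ∀ n i → I (suc n) i fzero ≡ e₀ i
  I-col₀ n fzero    = refl
  I-col₀ n (fsuc i) = I-offᴺ (suc n) (fsuc i) fzero λ ()

  addRow₀ : ∀ {n} → (Fin (suc n) → ℤ) → Matrix (suc n) (suc n)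
  addRow₀ {n} x i t = I (suc n) i t + x i * e₀ t

  addCol₀ : ∀ {n} → (Fin (suc n) → ℤ) → Matrix (suc n) (suc n)
  addCol₀ {n} y t j = I (suc n) t j + e₀ t * y j

  addRow₀-⊗ : ∀ {n k} (x : Fin (suc n) → ℤ) (M : Matrix (suc n) k) i j →
    (addRow₀ x ⊗ M) i j ≡ M i j + x i * M fzero j
  addRow₀-⊗ {n} x M i j = begin
      sumF (suc n) (λ t → (I (suc n) i t + x i * e₀ t) * M t j)
    ≡⟨ sumF-cong (suc n) (λ t → ℤP.*-distribʳ-+ (M t j) (I (suc n) i t) (x i * e₀ t)) ⟩
      sumF (suc n) (λ t → I (suc n) i t * M t j + x i * e₀ t * M t j)
    ≡⟨ sumF-distrib-+ (suc n) (λ t → I (suc n) i t * M t j) (λ t → x i * e₀ t * M t j) ⟩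
      (I (suc n) ⊗ M) i j + (x i * 1ℤ * M fzero j + sumF n (λ t → x i * 0ℤ * M (fsuc t) j))
    ≡⟨ cong₂ _+_ (⊗-identityˡ′ M i j)
                 (cong₂ _+_ (cong (_* M fzero j) (ℤP.*-identityʳ (x i)))
                            (sumF-zero n λ t → trans (cong (_* M (fsuc t) j) (ℤP.*-zeroʳ (x i))) refl)) ⟩
      M i j + (x i * M fzero j + 0ℤ)
    ≡⟨ cong (_+_ (M i j)) (ℤP.+-identityʳ _) ⟩
      M i j + x i * M fzero j ∎
    where open ≡-Reasoning

  ⊗-addCol₀ : ∀ {n k} (y : Fin (suc n) → ℤ) (M : Matrix k (suc n)) i j →
    (M ⊗ addCol₀ y) i j ≡ M i j + M i fzero * y j
  ⊗-addCol₀ {n} y M i j = begin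
      sumF (suc n) (λ t → M i t * (I (suc n) t j + e₀ t * y j))
    ≡⟨ sumF-cong (suc n) (λ t → ℤP.*-distribˡ-+ (M i t) (I (suc n) t j) (e₀ t * y j)) ⟩
      sumF (suc n) (λ t → M i t * I (suc n) t j + M i t * (e₀ t * y j))
    ≡⟨ sumF-distrib-+ (suc n) (λ t → M i t * I (suc n) t j) (λ t → M i t * (e₀ t * y j)) ⟩
      (M ⊗ I (suc n)) i j + (M i fzero * (1ℤ * y j) + sumF n (λ t → M i (fsuc t) * (0ℤ * y j)))
    ≡⟨ cong₂ _+_ (⊗-identityʳ′ M i j)
                 (cong₂ _+_ (cong (M i fzero *_) (ℤP.*-identityˡ (y j)))
                            (sumF-zero n λ t → ℤP.*-zeroʳ (M i (fsuc t)))) ⟩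
      M i j + (M i fzero * y j + 0ℤ)
    ≡⟨ cong (_+_ (M i j)) (ℤP.+-identityʳ _) ⟩
      M i j + M i fzero * y j ∎
    where open ≡-Reasoning

  addRow₀-inverse : ∀ {n} (x x′ : Fin (suc n) → ℤ) → x′ fzero ≡ 0ℤ → (∀ i → x i + x′ i ≡ 0ℤ) →
    addRow₀ x ⊗ addRow₀ x′ ≃ₘ I (suc n)
  addRow₀-inverse {n} x x′ x′₀≡0 x+x′≡0 = ≡⇒≃ₘ λ i j → begin
      (addRow₀ x ⊗ addRow₀ x′) i j
    ≡⟨ addRow₀-⊗ x (addRow₀ x′) i j ⟩
      (I (suc n) i j + x′ i * e₀ j) + x i * (I (suc n) fzero j + x′ fzero * e₀ j)
    ≡⟨ cong₂ (λ a b → (I (suc n) i j + x′ i * e₀ j) + x i * (a + b * e₀ j)) (I-row₀ n j) x′₀≡0 ⟩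
      (I (suc n) i j + x′ i * e₀ j) + x i * (e₀ j + 0ℤ * e₀ j)
    ≡⟨ collect (I (suc n) i j) (x i) (x′ i) (e₀ j) ⟩
      I (suc n) i j + (x i + x′ i) * e₀ j
    ≡⟨ cong (λ z → I (suc n) i j + z * e₀ j) (x+x′≡0 i) ⟩
      I (suc n) i j + 0ℤ
    ≡⟨ ℤP.+-identityʳ _ ⟩
      I (suc n) i j ∎
    where
    open ≡-Reasoning
    collect : ∀ a x x′ e → (a + x′ * e) + x * (e + 0ℤ * e) ≡ a + (x + x′) * e
    collect = solve-∀

  addCol₀-inverse : ∀ {n} (y y′ : Fin (suc n) → ℤ) → y fzero ≡ 0ℤ → (∀ j → y j + y′ j ≡ 0ℤ) →
    addCol₀ y ⊗ addCol₀ y′ ≃ₘ I (suc n)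
  addCol₀-inverse {n} y y′ y₀≡0 y+y′≡0 = ≡⇒≃ₘ λ i j → begin
      (addCol₀ y ⊗ addCol₀ y′) i j
    ≡⟨ ⊗-addCol₀ y′ (addCol₀ y) i j ⟩
      (I (suc n) i j + e₀ i * y j) + (I (suc n) i fzero + e₀ i * y fzero) * y′ j
    ≡⟨ cong₂ (λ a b → (I (suc n) i j + e₀ i * y j) + (a + e₀ i * b) * y′ j) (I-col₀ n i) y₀≡0 ⟩
      (I (suc n) i j + e₀ i * y j) + (e₀ i + e₀ i * 0ℤ) * y′ j
    ≡⟨ collect (I (suc n) i j) (y j) (y′ j) (e₀ i) ⟩
      I (suc n) i j + e₀ i * (y j + y′ j)
    ≡⟨ cong (λ z → I (suc n) i j + e₀ i * z) (y+y′≡0 j) ⟩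
      I (suc n) i j + e₀ i * 0ℤ
    ≡⟨ cong (_+_ (I (suc n) i j)) (ℤP.*-zeroʳ (e₀ i)) ⟩
      I (suc n) i j + 0ℤ
    ≡⟨ ℤP.+-identityʳ _ ⟩
      I (suc n) i j ∎
    where
    open ≡-Reasoning
    collect : ∀ a y y′ e → (a + e * y) + (e + e * 0ℤ) * y′ ≡ a + e * (y + y′)
    collect = solve-∀

  addRow₀-invertible : ∀ {n} (x : Fin (suc n) → ℤ) → x fzero ≡ 0ℤ → Invertible (suc n) (addRow₀ x)
  addRow₀-invertible x x₀≡0 = invertible (addRow₀ (-_ ∘ x))
    (addRow₀-inverse x (-_ ∘ x) (cong -_ x₀≡0) (λ i → ℤP.+-inverseʳ (x i)))
    (addRow₀-inverse (-_ ∘ x) x x₀≡0 (λ i → ℤP.+-inverseˡ (x i)))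

  addCol₀-invertible : ∀ {n} (y : Fin (suc n) → ℤ) → y fzero ≡ 0ℤ → Invertible (suc n) (addCol₀ y)
  addCol₀-invertible y y₀≡0 = invertible (addCol₀ (-_ ∘ y))
    (addCol₀-inverse y (-_ ∘ y) y₀≡0 (λ j → ℤP.+-inverseʳ (y j)))
    (addCol₀-inverse (-_ ∘ y) y (cong -_ y₀≡0) (λ j → ℤP.+-inverseˡ (y j)))

  ⊗-corner-col₀ : ∀ {m n} (X : Matrix m (suc n)) w i → (X ⊗ corner w (I n)) i fzero ≡ X i fzero * w
  ⊗-corner-col₀ {n = n} X w i =
    trans (cong (_+_ (X i fzero * w)) (sumF-zero n (λ t → ℤP.*-zeroʳ (X i (fsuc t))))) (ℤP.+-identityʳ _)

  ⊗-corner-colₛ : ∀ {m n} (X : Matrix m (suc n)) w i j → (X ⊗ corner w (I n)) i (fsuc j) ≡ X i (fsuc j)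
  ⊗-corner-colₛ {n = n} X w i j =
    trans (cong (_+ sumF n (λ t → X i (fsuc t) * I n t j)) (ℤP.*-zeroʳ (X i fzero)))
          (trans (ℤP.+-identityˡ _) (⊗-identityʳ′ (λ i′ t → X i′ (fsuc t)) i j))

  -- Row and column operations clearing row 0 and column 0 of N, given an inverse w of the pivot N₀₀;
  -- what remains is the Schur complement.
  module Elimination {m a} (N : Matrix (suc m) (suc a)) (w : ℤ) (uw≃1 : N fzero fzero * w ≃ 1ℤ) where

    rowFactor : Fin (suc m) → ℤ
    rowFactor fzero    = 0ℤ
    rowFactor (fsuc i) = - (N (fsuc i) fzero * w)

    colFactor : Fin (suc a) → ℤ
    colFactor fzero    = 0ℤ
    colFactor (fsuc j) = - (w * N fzero (fsuc j))

    L : Matrix (suc m) (suc m)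
    L = addRow₀ rowFactor

    R : Matrix (suc a) (suc a)
    R = addCol₀ colFactor ⊗ corner w (I a)

    L-invertible : Invertible (suc m) L
    L-invertible = addRow₀-invertible rowFactor refl

    R-invertible : Invertible (suc a) R
    R-invertible = ⊗-invertible (addCol₀-invertible colFactor refl)
      (corner-invertible w (N fzero fzero) (≃-trans (≃-reflexive (ℤP.*-comm w _)) uw≃1) uw≃1 (I-invertible a))

    complement : Matrix m a
    complement i j = N (fsuc i) (fsuc j) + rowFactor (fsuc i) * N fzero (fsuc j)

    private
      K : Matrix (suc m) (suc a)
      K = L ⊗ N

      K-entry : ∀ i j → K i j ≡ N i j + rowFactor i * N fzero j
      K-entry = addRow₀-⊗ rowFactor N

      1-uw≃0 : 1ℤ - N fzero fzero * w ≃ 0ℤ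
      1-uw≃0 = +-cong (≃-refl {1ℤ}) (-‿cong uw≃1)

      K-row₀ : ∀ j → K fzero j ≡ N fzero j
      K-row₀ j = trans (K-entry fzero j) (ℤP.+-identityʳ (N fzero j))

      K-col₀ : ∀ i → K (fsuc i) fzero ≃ 0ℤ
      K-col₀ i = ≃-trans (≃-reflexive (trans (K-entry (fsuc i) fzero) (factor (N (fsuc i) fzero) (N fzero fzero) w)))
                         (≃-trans (*-cong (≃-refl {N (fsuc i) fzero}) 1-uw≃0) (≃-reflexive (ℤP.*-zeroʳ (N (fsuc i) fzero))))
        where
        factor : ∀ v u w → v + - (v * w) * u ≡ v * (1ℤ - u * w)
        factor = solve-∀

      KC : Matrix (suc m) (suc a)
      KC = K ⊗ addCol₀ colFactor

      KC-entry : ∀ i j → KC i j ≡ K i j + K i fzero * colFactor j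
      KC-entry = ⊗-addCol₀ colFactor K

      KCR-pivot : (KC ⊗ corner w (I a)) fzero fzero ≃ 1ℤ
      KCR-pivot = ≃-trans (≃-reflexive (trans (⊗-corner-col₀ KC w fzero) (cong (_* w) KC₀₀≡u))) uw≃1
        where
        +*0 : ∀ u → u + u * 0ℤ ≡ u
        +*0 = solve-∀
        KC₀₀≡u : KC fzero fzero ≡ N fzero fzero
        KC₀₀≡u = trans (KC-entry fzero fzero) (trans (cong (λ k → k + k * 0ℤ) (K-row₀ fzero)) (+*0 (N fzero fzero)))

      KCR-row₀ : ∀ j → (KC ⊗ corner w (I a)) fzero (fsuc j) ≃ 0ℤ
      KCR-row₀ j = begin
          (KC ⊗ corner w (I a)) fzero (fsuc j)
        ≡⟨ trans (⊗-corner-colₛ KC w fzero j) (KC-entry fzero (fsuc j)) ⟩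
          K fzero (fsuc j) + K fzero fzero * - (w * N fzero (fsuc j))
        ≡⟨ cong₂ (λ k k₀ → k + k₀ * - (w * N fzero (fsuc j))) (K-row₀ (fsuc j)) (K-row₀ fzero) ⟩
          N fzero (fsuc j) + N fzero fzero * - (w * N fzero (fsuc j))
        ≡⟨ factor (N fzero (fsuc j)) (N fzero fzero) w ⟩
          N fzero (fsuc j) * (1ℤ - N fzero fzero * w)
        ≈⟨ *-cong (≃-refl {N fzero (fsuc j)}) 1-uw≃0 ⟩
          N fzero (fsuc j) * 0ℤ
        ≡⟨ ℤP.*-zeroʳ (N fzero (fsuc j)) ⟩
          0ℤ ∎
        where
        open SetoidReasoning ≃-setoid
        factor : ∀ v u w → v + u * - (w * v) ≡ v * (1ℤ - u * w)
        factor = solve-∀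

      KCR-col₀ : ∀ i → (KC ⊗ corner w (I a)) (fsuc i) fzero ≃ 0ℤ
      KCR-col₀ i = ≃-trans (≃-reflexive (trans (⊗-corner-col₀ KC w (fsuc i)) (cong (_* w) (KC-entry (fsuc i) fzero))))
                           (*-cong (+-cong (K-col₀ i) (*-cong (K-col₀ i) (≃-refl {0ℤ}))) (≃-refl {w}))

      KCR-rest : ∀ i j → (KC ⊗ corner w (I a)) (fsuc i) (fsuc j) ≃ complement i j
      KCR-rest i j = begin
          (KC ⊗ corner w (I a)) (fsuc i) (fsuc j)
        ≡⟨ trans (⊗-corner-colₛ KC w (fsuc i) j) (KC-entry (fsuc i) (fsuc j)) ⟩
          K (fsuc i) (fsuc j) + K (fsuc i) fzero * colFactor (fsuc j)
        ≈⟨ +-cong (≃-refl {K (fsuc i) (fsuc j)}) (*-cong (K-col₀ i) (≃-refl {colFactor (fsuc j)})) ⟩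
          K (fsuc i) (fsuc j) + 0ℤ
        ≡⟨ trans (ℤP.+-identityʳ _) (K-entry (fsuc i) (fsuc j)) ⟩
          complement i j ∎
        where open SetoidReasoning ≃-setoid

    eliminate : (L ⊗ N) ⊗ R ≃ₘ corner 1ℤ complement
    eliminate = ≃ₘ-trans (≃ₘ-sym (⊗-assoc K (addCol₀ colFactor) (corner w (I a)))) λ where
      fzero    fzero    → KCR-pivot
      fzero    (fsuc j) → KCR-row₀ j
      (fsuc i) fzero    → KCR-col₀ i
      (fsuc i) (fsuc j) → KCR-rest i j

  [_∣_] : ∀ {m x y} → Matrix m x → Matrix m y → Matrix m (x ℕ.+ y)
  [_∣_] {x = x} A B i j = [ A i , B i ]′ (splitAt x j)

  block : ∀ {x y x′ y′} → Matrix x x′ → Matrix x y′ → Matrix y x′ → Matrix y y′ →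
    Matrix (x ℕ.+ y) (x′ ℕ.+ y′)
  block {x} A B C D i = [ [ A ∣ B ] , [ C ∣ D ] ]′ (splitAt x i)

  [∣]-↑ˡ : ∀ {m x y} (A : Matrix m x) (B : Matrix m y) i j → [ A ∣ B ] i (j ↑ˡ y) ≡ A i j
  [∣]-↑ˡ {x = x} {y} A B i j rewrite FinP.splitAt-↑ˡ x j y = refl

  [∣]-↑ʳ : ∀ {m x y} (A : Matrix m x) (B : Matrix m y) i j → [ A ∣ B ] i (x ↑ʳ j) ≡ B i j
  [∣]-↑ʳ {x = x} {y} A B i j rewrite FinP.splitAt-↑ʳ x y j = refl

  block-↑ˡ : ∀ {x y x′ y′} (A : Matrix x x′) (B : Matrix x y′) (C : Matrix y x′) (D : Matrix y y′) i j →
    block A B C D (i ↑ˡ y) j ≡ [ A ∣ B ] i j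
  block-↑ˡ {x} {y} A B C D i j rewrite FinP.splitAt-↑ˡ x i y = refl

  block-↑ʳ : ∀ {x y x′ y′} (A : Matrix x x′) (B : Matrix x y′) (C : Matrix y x′) (D : Matrix y y′) i j →
    block A B C D (x ↑ʳ i) j ≡ [ C ∣ D ] i j
  block-↑ʳ {x} {y} A B C D i j rewrite FinP.splitAt-↑ʳ x y i = refl

  [∣]-cong : ∀ {m x y} {A A′ : Matrix m x} {B B′ : Matrix m y} →
    A ≃ₘ A′ → B ≃ₘ B′ → [ A ∣ B ] ≃ₘ [ A′ ∣ B′ ]
  [∣]-cong {x = x} A≃A′ B≃B′ i j with splitAt x j
  ... | inj₁ j′ = A≃A′ i j′
  ... | inj₂ j′ = B≃B′ i j′

  [∣]-⊕ : ∀ {m x y} (A C : Matrix m x) (B D : Matrix m y) → [ A ∣ B ] ⊕ [ C ∣ D ] ≃ₘ [ A ⊕ C ∣ B ⊕ D ]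
  [∣]-⊕ {x = x} A C B D i j with splitAt x j
  ... | inj₁ _ = ≃-refl
  ... | inj₂ _ = ≃-refl

  ⊗-[∣] : ∀ {m l x y} (X : Matrix m l) (A : Matrix l x) (B : Matrix l y) → X ⊗ [ A ∣ B ] ≃ₘ [ X ⊗ A ∣ X ⊗ B ]
  ⊗-[∣] {x = x} X A B i j with splitAt x j
  ... | inj₁ _ = ≃-refl
  ... | inj₂ _ = ≃-refl

  [∣]-⊗ : ∀ {m x y n} (A : Matrix m x) (B : Matrix m y) (K : Matrix (x ℕ.+ y) n) →
    [ A ∣ B ] ⊗ K ≃ₘ A ⊗ (λ t → K (t ↑ˡ y)) ⊕ B ⊗ (λ t → K (x ↑ʳ t))
  [∣]-⊗ {x = x} {y} A B K = ≡⇒≃ₘ λ i j → trans (sumF-splitAt x y _)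
    (cong₂ _+_ (sumF-cong x (λ t → cong (_* K (t ↑ˡ y) j) ([∣]-↑ˡ A B i t)))
               (sumF-cong y (λ t → cong (_* K (x ↑ʳ t) j) ([∣]-↑ʳ A B i t))))

  [∣]-⊗-block : ∀ {m x y x′ y′} (A : Matrix m x) (B : Matrix m y)
    (E : Matrix x x′) (F : Matrix x y′) (G : Matrix y x′) (H : Matrix y y′) →
    [ A ∣ B ] ⊗ block E F G H ≃ₘ [ A ⊗ E ⊕ B ⊗ G ∣ A ⊗ F ⊕ B ⊗ H ]
  [∣]-⊗-block {m} {x} {y} {x′} {y′} A B E F G H = begin
      [ A ∣ B ] ⊗ block E F G H
    ≈⟨ [∣]-⊗ A B (block E F G H) ⟩
      A ⊗ (λ t → block E F G H (t ↑ˡ y)) ⊕ B ⊗ (λ t → block E F G H (x ↑ʳ t))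
    ≈⟨ ⊕-cong (⊗-congʳ A (≡⇒≃ₘ (block-↑ˡ E F G H))) (⊗-congʳ B (≡⇒≃ₘ (block-↑ʳ E F G H))) ⟩
      A ⊗ [ E ∣ F ] ⊕ B ⊗ [ G ∣ H ]
    ≈⟨ ⊕-cong (⊗-[∣] A E F) (⊗-[∣] B G H) ⟩
      [ A ⊗ E ∣ A ⊗ F ] ⊕ [ B ⊗ G ∣ B ⊗ H ]
    ≈⟨ [∣]-⊕ (A ⊗ E) (B ⊗ G) (A ⊗ F) (B ⊗ H) ⟩
      [ A ⊗ E ⊕ B ⊗ G ∣ A ⊗ F ⊕ B ⊗ H ] ∎
    where open SetoidReasoning (≃ₘ-setoid m (x′ ℕ.+ y′))

  block-⊗-block : ∀ {x y x′ y′ x″ y″} (A : Matrix x x′) (B : Matrix x y′) (C : Matrix y x′) (D : Matrix y y′)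
    (E : Matrix x′ x″) (F : Matrix x′ y″) (G : Matrix y′ x″) (H : Matrix y′ y″) →
    block A B C D ⊗ block E F G H ≃ₘ block (A ⊗ E ⊕ B ⊗ G) (A ⊗ F ⊕ B ⊗ H) (C ⊗ E ⊕ D ⊗ G) (C ⊗ F ⊕ D ⊗ H)
  block-⊗-block {x} A B C D E F G H i j with splitAt x i
  ... | inj₁ i′ = [∣]-⊗-block A B E F G H i′ j
  ... | inj₂ i′ = [∣]-⊗-block C D E F G H i′ j

  block-cong : ∀ {x y x′ y′} {A A′ : Matrix x x′} {B B′ : Matrix x y′} {C C′ : Matrix y x′} {D D′ : Matrix y y′} →
    A ≃ₘ A′ → B ≃ₘ B′ → C ≃ₘ C′ → D ≃ₘ D′ → block A B C D ≃ₘ block A′ B′ C′ D′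
  block-cong {x} A≃A′ B≃B′ C≃C′ D≃D′ i with splitAt x i
  ... | inj₁ i′ = [∣]-cong A≃A′ B≃B′ i′
  ... | inj₂ i′ = [∣]-cong C≃C′ D≃D′ i′

  splitAt-elim : ∀ x y {ℓ} (P : Fin (x ℕ.+ y) → Set ℓ) →
    (∀ i → P (i ↑ˡ y)) → (∀ j → P (x ↑ʳ j)) → ∀ k → P k
  splitAt-elim x y P left right k = subst P (FinP.join-splitAt x y k) (by-side (splitAt x k))
    where
    by-side : ∀ z → P (join x y z)
    by-side (inj₁ i) = left i
    by-side (inj₂ j) = right j

  I-block : ∀ x y → I (x ℕ.+ y) ≃ₘ block (I x) 𝟘 𝟘 (I y)
  I-block x y = ≡⇒≃ₘ (splitAt-elim x y _
    (λ i → splitAt-elim x y _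
      (λ j → trans (I-shifted (i ↑ˡ y) (j ↑ˡ y) i j 0 (FinP.toℕ-↑ˡ i y) (FinP.toℕ-↑ˡ j y))
                   (sym (trans (block-↑ˡ (I x) 𝟘 𝟘 (I y) i (j ↑ˡ y)) ([∣]-↑ˡ (I x) 𝟘 i j))))
      (λ j → trans (I-offᴺ _ (i ↑ˡ y) (x ↑ʳ j) (left≢right i j))
                   (sym (trans (block-↑ˡ (I x) 𝟘 𝟘 (I y) i (x ↑ʳ j)) ([∣]-↑ʳ (I x) 𝟘 i j)))))
    (λ i → splitAt-elim x y _
      (λ j → trans (I-offᴺ _ (x ↑ʳ i) (j ↑ˡ y) (left≢right j i ∘ sym))
                   (sym (trans (block-↑ʳ (I x) 𝟘 𝟘 (I y) i (j ↑ˡ y)) ([∣]-↑ˡ (𝟘 {y} {x}) (I y) i j))))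
      (λ j → trans (I-shifted (x ↑ʳ i) (x ↑ʳ j) i j x (FinP.toℕ-↑ʳ x i) (FinP.toℕ-↑ʳ x j))
                   (sym (trans (block-↑ʳ (I x) 𝟘 𝟘 (I y) i (x ↑ʳ j)) ([∣]-↑ʳ (𝟘 {y} {x}) (I y) i j))))))
    where
    left≢right : ∀ (i : Fin x) (j : Fin y) → toℕ (i ↑ˡ y) ≢ toℕ (x ↑ʳ j)
    left≢right i j eq = ℕP.<⇒≢ (ℕP.<-≤-trans (FinP.toℕ<n i) (ℕP.m≤m+n x (toℕ j)))
                                (trans (sym (FinP.toℕ-↑ˡ i y)) (trans eq (FinP.toℕ-↑ʳ x j)))

  [𝟘∣I]⊗block : ∀ {x y x′ y′} (E : Matrix x x′) (F : Matrix x y′) (G : Matrix y x′) (H : Matrix y y′) →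
    [ 𝟘 {y} {x} ∣ I y ] ⊗ block E F G H ≃ₘ [ G ∣ H ]
  [𝟘∣I]⊗block {x = x} {y} E F G H = ≃ₘ-trans ([∣]-⊗-block 𝟘 (I y) E F G H)
    ([∣]-cong (≃ₘ-trans (⊕-cong (⊗-zeroˡ E) (⊗-identityˡ G)) (⊕-identityˡ G))
              (≃ₘ-trans (⊕-cong (⊗-zeroˡ F) (⊗-identityˡ H)) (⊕-identityˡ H)))

  ⊗-[𝟘∣I] : ∀ {m x y} (K : Matrix m y) → K ⊗ [ 𝟘 {y} {x} ∣ I y ] ≃ₘ [ 𝟘 ∣ K ]
  ⊗-[𝟘∣I] K = ≃ₘ-trans (⊗-[∣] K 𝟘 (I _)) ([∣]-cong (⊗-zeroʳ K) (⊗-identityʳ K))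

  block-upper-invertible : ∀ {x y} {A : Matrix x x} {D : Matrix y y} (B : Matrix x y) →
    Invertible x A → Invertible y D → Invertible (x ℕ.+ y) (block A B 𝟘 D)
  block-upper-invertible {x} {y} {A} {D} B (invertible A′ AA′ A′A) (invertible D′ DD′ D′D) =
    invertible (block A′ B′ 𝟘 D′)
      (≃ₘ-trans (block-⊗-block A B 𝟘 D A′ B′ 𝟘 D′)
                (≃ₘ-trans (block-cong top-left₁ top-right₁ (bottom-left A′ D) (bottom-right B′ D D′ DD′))
                          (≃ₘ-sym (I-block x y))))
      (≃ₘ-trans (block-⊗-block A′ B′ 𝟘 D′ A B 𝟘 D)
                (≃ₘ-trans (block-cong top-left₂ top-right₂ (bottom-left A D′) (bottom-right B D′ D D′D))
                          (≃ₘ-sym (I-block x y))))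
    where
    B′ : Matrix x y
    B′ = ⊖ ((A′ ⊗ B) ⊗ D′)
    bottom-left : ∀ {z} (X : Matrix x z) (Y : Matrix y y) → 𝟘 ⊗ X ⊕ Y ⊗ 𝟘 ≃ₘ 𝟘
    bottom-left X Y = ≃ₘ-trans (⊕-cong (⊗-zeroˡ X) (⊗-zeroʳ Y)) (⊕-identityˡ 𝟘)
    bottom-right : (X : Matrix x y) (Y Y′ : Matrix y y) → Y ⊗ Y′ ≃ₘ I y → 𝟘 ⊗ X ⊕ Y ⊗ Y′ ≃ₘ I y
    bottom-right X Y Y′ YY′≃I = ≃ₘ-trans (⊕-cong (⊗-zeroˡ X) YY′≃I) (⊕-identityˡ (I y))
    top-left₁ : A ⊗ A′ ⊕ B ⊗ 𝟘 ≃ₘ I x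
    top-left₁ = ≃ₘ-trans (⊕-cong AA′ (⊗-zeroʳ B)) (⊕-identityʳ (I x))
    top-left₂ : A′ ⊗ A ⊕ B′ ⊗ 𝟘 ≃ₘ I x
    top-left₂ = ≃ₘ-trans (⊕-cong A′A (⊗-zeroʳ B′)) (⊕-identityʳ (I x))
    top-right₁ : A ⊗ B′ ⊕ B ⊗ D′ ≃ₘ 𝟘
    top-right₁ = ≃ₘ-trans (⊕-cong (≃ₘ-trans (⊖-distribʳ-⊗ A _) (⊖-cong (≃ₘ-trans (⊗-congʳ A (⊗-assoc A′ B D′))
                                                                               (cancelˡ A A′ (B ⊗ D′) AA′))))
                                  (≃ₘ-refl {A = B ⊗ D′}))
                          (⊕-inverseˡ (B ⊗ D′))
    top-right₂ : A′ ⊗ B ⊕ B′ ⊗ D ≃ₘ 𝟘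
    top-right₂ = ≃ₘ-trans (⊕-cong (≃ₘ-refl {A = A′ ⊗ B})
                                  (≃ₘ-trans (⊖-distribˡ-⊗ ((A′ ⊗ B) ⊗ D′) D) (⊖-cong (cancelʳ (A′ ⊗ B) D′ D D′D))))
                          (⊕-inverseʳ (A′ ⊗ B))

  pℤ : ℤ
  pℤ = + p

  p^_ : ℕ → ℤ
  p^ c = + (p ^ c)

  p^-suc : ∀ c → p^ suc c ≡ pℤ * p^ c
  p^-suc c = ℤP.pos-* p (p ^ c)

  p^s*≃0 : ∀ x → p^ s * x ≃ 0ℤ
  p^s*≃0 x = ≡+*q⇒≃ x (trans (ℤP.*-comm qℤ x) (sym (ℤP.+-identityˡ (x * qℤ))))

  ≋I⇒≃I⊕p𝟘 : ∀ {m} {M : Matrix m m} → M ≋ I m → M ≃ₘ I m ⊕ pℤ ·ₘ 𝟘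
  ≋I⇒≃I⊕p𝟘 {m} M≋I i j =
    ≃-trans ⟨ M≋I i j ⟩ (≃-reflexive (sym (trans (cong (_+_ (I m i j)) (ℤP.*-zeroʳ pℤ)) (ℤP.+-identityʳ _))))

  Dentry-off : ∀ r e i j → i ≢ j → Dentry r e i j ≡ 0ℤ
  Dentry-off r e i j i≢j with i ℕP.≟ j | i <? r
  ... | yes i≡j | _ = ⊥-elim (i≢j i≡j)
  ... | no  _   | _ = refl

  Dentry-beyond : ∀ r e i j → r ℕ.≤ i → Dentry r e i j ≡ 0ℤ
  Dentry-beyond r e i j r≤i with i ℕP.≟ j | i <? r
  ... | yes _ | yes i<r = ⊥-elim (ℕP.<⇒≱ i<r r≤i)
  ... | yes _ | no  _   = refl
  ... | no  _ | _       = refl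

  Dentry-diag : ∀ r e i (i<r : i ℕ.< r) → Dentry r e i i ≡ p^ e (fromℕ< i<r)
  Dentry-diag r e i i<r with i ℕP.≟ i | i <? r
  ... | yes _   | yes i<r′ = cong (λ k → p^ e k) (FinP.fromℕ<-cong i i refl i<r′ i<r)
  ... | yes _   | no  i≮r  = ⊥-elim (i≮r i<r)
  ... | no  i≢i | _        = ⊥-elim (i≢i refl)

  Dentry-col-beyond : ∀ r e i j → r ℕ.≤ j → Dentry r e i j ≡ 0ℤ
  Dentry-col-beyond r e i j r≤j = by-cases (i ℕP.≟ j)
    where
    by-cases : Dec (i ≡ j) → Dentry r e i j ≡ 0ℤ
    by-cases (yes refl) = Dentry-beyond r e i i r≤j
    by-cases (no  i≢j)  = Dentry-off r e i j i≢j

  Dentry-suc : ∀ r e i j → Dentry (suc r) e (suc i) (suc j) ≡ Dentry r (e ∘ fsuc) i j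
  Dentry-suc r e i j = by-cases (i ℕP.≟ j)
    where
    on-diagonal : Dec (i ℕ.< r) → Dentry (suc r) e (suc i) (suc i) ≡ Dentry r (e ∘ fsuc) i i
    on-diagonal (yes i<r) = trans (Dentry-diag (suc r) e (suc i) (s≤s i<r)) (sym (Dentry-diag r (e ∘ fsuc) i i<r))
    on-diagonal (no  i≮r) = trans (Dentry-beyond (suc r) e (suc i) (suc i) (s≤s (ℕP.≮⇒≥ i≮r)))
                                  (sym (Dentry-beyond r (e ∘ fsuc) i i (ℕP.≮⇒≥ i≮r)))
    by-cases : Dec (i ≡ j) → Dentry (suc r) e (suc i) (suc j) ≡ Dentry r (e ∘ fsuc) i j
    by-cases (yes refl) = on-diagonal (i <? r)
    by-cases (no  i≢j)  = trans (Dentry-off (suc r) e (suc i) (suc j) (i≢j ∘ ℕP.suc-injective))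
                                (sym (Dentry-off r (e ∘ fsuc) i j i≢j))

  Dentry-divisible : ∀ r e i j → (∀ (i<r : i ℕ.< r) → 1 ℕ.≤ e (fromℕ< i<r)) → ∃[ d ] Dentry r e i j ≡ pℤ * d
  Dentry-divisible r e i j positive = by-cases (i ℕP.≟ j)
    where
    on-diagonal : Dec (i ℕ.< r) → ∃[ d ] Dentry r e i i ≡ pℤ * d
    on-diagonal (no  i≮r) = 0ℤ , trans (Dentry-beyond r e i i (ℕP.≮⇒≥ i≮r)) (sym (ℤP.*-zeroʳ pℤ))
    on-diagonal (yes i<r) with e (fromℕ< i<r) in eᵢ≡ | positive i<r
    ... | suc c | _ = p^ c , trans (Dentry-diag r e i i<r) (trans (cong p^_ eᵢ≡) (p^-suc c))
    by-cases : Dec (i ≡ j) → ∃[ d ] Dentry r e i j ≡ pℤ * d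
    by-cases (yes refl) = on-diagonal (i <? r)
    by-cases (no  i≢j)  = 0ℤ , trans (Dentry-off r e i j i≢j) (sym (ℤP.*-zeroʳ pℤ))

  Diag : ∀ m a r → (Fin r → ℕ) → Matrix m a
  Diag m a r e i j = Dentry r e (toℕ i) (toℕ j)

  _∷ᵉ_ : ∀ {r} → ℕ → (Fin r → ℕ) → Fin (suc r) → ℕ
  (c ∷ᵉ e) fzero    = c
  (c ∷ᵉ e) (fsuc x) = e x

  Diag-suc : ∀ m a r c e → Diag (suc m) (suc a) (suc r) (c ∷ᵉ e) ≃ₘ corner (p^ c) (Diag m a r e)
  Diag-suc m a r c e = ≡⇒≃ₘ λ where
    fzero    fzero    → Dentry-diag (suc r) (c ∷ᵉ e) 0 (s≤s z≤n)
    fzero    (fsuc j) → Dentry-off (suc r) (c ∷ᵉ e) 0 (suc (toℕ j)) λ ()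
    (fsuc i) fzero    → Dentry-off (suc r) (c ∷ᵉ e) (suc (toℕ i)) 0 λ ()
    (fsuc i) (fsuc j) → Dentry-suc r (c ∷ᵉ e) (toℕ i) (toℕ j)

  Diag-zero : ∀ m a e → Diag m a 0 e ≃ₘ 𝟘
  Diag-zero m a e = ≡⇒≃ₘ λ i j → Dentry-beyond 0 e (toℕ i) (toℕ j) z≤n

  sandwich-assoc : ∀ {m a} (A B : Matrix m m) (M : Matrix m a) (C D : Matrix a a) →
    ((A ⊗ B) ⊗ M) ⊗ (C ⊗ D) ≃ₘ (A ⊗ ((B ⊗ M) ⊗ C)) ⊗ D
  sandwich-assoc A B M C D =
    ≃ₘ-trans (≃ₘ-sym (⊗-assoc ((A ⊗ B) ⊗ M) C D))
             (⊗-congˡ D (≃ₘ-trans (⊗-congˡ C (⊗-assoc A B M)) (⊗-assoc A (B ⊗ M) C)))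

  ·ₘ-sandwich : ∀ {m a} (L : Matrix m m) c (N : Matrix m a) (R : Matrix a a) →
    (L ⊗ (c ·ₘ N)) ⊗ R ≃ₘ c ·ₘ ((L ⊗ N) ⊗ R)
  ·ₘ-sandwich L c N R = ≃ₘ-trans (⊗-congˡ R (⊗-·ₘ-comm L c N)) (·ₘ-assoc-⊗ c (L ⊗ N) R)

  ·ₘ-corner-1 : ∀ {m a} c (A : Matrix m a) → c ·ₘ corner 1ℤ A ≃ₘ corner c (c ·ₘ A)
  ·ₘ-corner-1 c A = ≡⇒≃ₘ λ where
    fzero    fzero    → ℤP.*-identityʳ c
    fzero    (fsuc j) → ℤP.*-zeroʳ c
    (fsuc i) fzero    → ℤP.*-zeroʳ c
    (fsuc i) (fsuc j) → refl

  ZeroI-δ : ∀ n k (i : Fin k) (j : Fin n) → ZeroI n k i j ≡ δ (toℕ j) ((n ∸ k) ℕ.+ toℕ i)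
  ZeroI-δ n k i j with toℕ j ℕP.≟ (n ∸ k) ℕ.+ toℕ i
  ... | yes _ = refl
  ... | no  _ = refl

  DI-left : ∀ n m r e (i : Fin m) (j : Fin n) → toℕ j ℕ.< n ∸ m → DI n m r e i j ≡ Dentry r e (toℕ i) (toℕ j)
  DI-left n m r e i j j<n-m with toℕ j <? n ∸ m
  ... | yes _     = refl
  ... | no  j≮n-m = ⊥-elim (j≮n-m j<n-m)

  DI-right : ∀ n m r e (i : Fin m) (j : Fin n) → n ∸ m ℕ.≤ toℕ j → DI n m r e i j ≡ δ (toℕ j) ((n ∸ m) ℕ.+ toℕ i)
  DI-right n m r e i j n-m≤j with toℕ j <? n ∸ m
  ... | yes j<n-m = ⊥-elim (ℕP.<⇒≱ j<n-m n-m≤j)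
  ... | no  _ with toℕ j ℕP.≟ (n ∸ m) ℕ.+ toℕ i
  ...   | yes _ = refl
  ...   | no  _ = refl

  ZeroI-[∣] : ∀ a k → ZeroI (a ℕ.+ k) k ≃ₘ [ 𝟘 {k} {a} ∣ I k ]
  ZeroI-[∣] a k i = splitAt-elim a k _
    (λ j → ≃-reflexive (trans (ZeroI-δ _ k i (j ↑ˡ k))
                       (trans (δ-off (left≢ j)) (sym ([∣]-↑ˡ (𝟘 {k} {a}) (I k) i j)))))
    (λ j → ≃-reflexive (trans (ZeroI-δ _ k i (a ↑ʳ j))
                       (trans (cong₂ δ (FinP.toℕ-↑ʳ a j) (cong (ℕ._+ toℕ i) a+k-k≡a))
                       (trans (δ-+ a (toℕ j) (toℕ i))
                       (sym (trans ([∣]-↑ʳ (𝟘 {k} {a}) (I k) i j) (I-δ k i j)))))))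
    where
    a+k-k≡a : (a ℕ.+ k) ∸ k ≡ a
    a+k-k≡a = ℕP.m+n∸n≡m a k
    left≢ : ∀ j → toℕ (j ↑ˡ k) ≢ (a ℕ.+ k) ∸ k ℕ.+ toℕ i
    left≢ j eq = ℕP.<⇒≱ (FinP.toℕ<n j)
      (ℕP.≤-trans (ℕP.m≤m+n a (toℕ i))
                  (ℕP.≤-reflexive (trans (cong (ℕ._+ toℕ i) (sym a+k-k≡a)) (trans (sym eq) (FinP.toℕ-↑ˡ j k)))))

  DI-[∣] : ∀ a k m r e → m ℕ.≤ k → r ℕ.≤ a → DI (a ℕ.+ k) m r e ≃ₘ [ Diag m a r e ∣ ZeroI k m ]
  DI-[∣] a k m r e m≤k r≤a i = splitAt-elim a k _
    (λ j → ≃-reflexive (trans (DI-left _ m r e i (j ↑ˡ k) (left< j))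
                       (trans (cong (Dentry r e (toℕ i)) (FinP.toℕ-↑ˡ j k)) (sym ([∣]-↑ˡ (Diag m a r e) (ZeroI k m) i j)))))
    (λ j → ≃-reflexive (trans (right j (toℕ (a ↑ʳ j) <? (a ℕ.+ k) ∸ m))
                       (sym ([∣]-↑ʳ (Diag m a r e) (ZeroI k m) i j))))
    where
    a+k-m≡a+[k-m] : (a ℕ.+ k) ∸ m ≡ a ℕ.+ (k ∸ m)
    a+k-m≡a+[k-m] = ℕP.+-∸-assoc a m≤k
    a≤a+k-m : a ℕ.≤ (a ℕ.+ k) ∸ m
    a≤a+k-m = subst (a ℕ.≤_) (sym a+k-m≡a+[k-m]) (ℕP.m≤m+n a _)
    left< : ∀ j → toℕ (j ↑ˡ k) ℕ.< (a ℕ.+ k) ∸ m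
    left< j = subst (ℕ._< (a ℕ.+ k) ∸ m) (sym (FinP.toℕ-↑ˡ j k)) (ℕP.<-≤-trans (FinP.toℕ<n j) a≤a+k-m)
    right : ∀ j → Dec (toℕ (a ↑ʳ j) ℕ.< (a ℕ.+ k) ∸ m) → DI (a ℕ.+ k) m r e i (a ↑ʳ j) ≡ ZeroI k m i j
    -- Columns a + j < a + k − m belong to the D part of DI but lie beyond r ≤ a, so both sides vanish.
    right j (yes a+j<a+k-m) = trans (DI-left _ m r e i (a ↑ʳ j) a+j<a+k-m)
      (trans (Dentry-col-beyond r e (toℕ i) _ (ℕP.≤-trans r≤a (subst (a ℕ.≤_) (sym (FinP.toℕ-↑ʳ a j)) (ℕP.m≤m+n a _))))
             (sym (trans (ZeroI-δ k m i j) (δ-off λ j≡k-m+i → ℕP.<⇒≱ a+j<a+k-m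
               (ℕP.≤-trans (ℕP.≤-reflexive a+k-m≡a+[k-m])
                           (ℕP.≤-trans (ℕP.+-monoʳ-≤ a (ℕP.m≤m+n (k ∸ m) (toℕ i)))
                                       (ℕP.≤-reflexive (trans (cong (a ℕ.+_) (sym j≡k-m+i)) (sym (FinP.toℕ-↑ʳ a j))))))))))
    right j (no a+j≮a+k-m) = trans (DI-right _ m r e i (a ↑ʳ j) (ℕP.≮⇒≥ a+j≮a+k-m))
      (trans (cong₂ δ (FinP.toℕ-↑ʳ a j) (trans (cong (ℕ._+ toℕ i) a+k-m≡a+[k-m]) (ℕP.+-assoc a (k ∸ m) (toℕ i))))
             (trans (δ-+ a (toℕ j) _) (sym (ZeroI-δ k m i j))))

  record ZeroPrefix {r} (e : Fin r → ℕ) : Set where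
    field
      length         : ℕ
      length≤r       : length ℕ.≤ r
      zero-below     : ∀ x → toℕ x ℕ.< length → e x ≡ 0
      positive-above : ∀ x → length ℕ.≤ toℕ x → 1 ℕ.≤ e x

  zero-prefix : ∀ r (e : Fin r → ℕ) → (∀ x y → x ≤ᶠ y → e x ℕ.≤ e y) → ZeroPrefix e
  zero-prefix zero    e mono = record { length = 0 ; length≤r = z≤n ; zero-below = λ _ () ; positive-above = λ () }
  zero-prefix (suc r) e mono with e fzero in e₀≡
  ... | suc _ = record
    { length = 0 ; length≤r = z≤n ; zero-below = λ _ ()
    ; positive-above = λ x _ → ℕP.≤-trans (ℕP.≤-trans (s≤s z≤n) (ℕP.≤-reflexive (sym e₀≡))) (mono fzero x z≤n) }
  ... | zero  = record
    { length = suc length ; length≤r = s≤s length≤r ; zero-below = below ; positive-above = above }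
    where
    open ZeroPrefix (zero-prefix r (e ∘ fsuc) (λ x y x≤y → mono (fsuc x) (fsuc y) (s≤s x≤y)))
    below : ∀ x → toℕ x ℕ.< suc length → e x ≡ 0
    below fzero    _           = e₀≡
    below (fsuc x) (s≤s x<len) = zero-below x x<len
    above : ∀ x → suc length ℕ.≤ toℕ x → 1 ℕ.≤ e x
    above (fsuc x) (s≤s len≤x) = positive-above x len≤x

  module Rotation (x y : ℕ) where

    private
      y+x≡x+y : y ℕ.+ x ≡ x ℕ.+ y
      y+x≡x+y = ℕP.+-comm y x
      x+y≡y+x : x ℕ.+ y ≡ y ℕ.+ x
      x+y≡y+x = ℕP.+-comm x y

    rotate unrotate : Fin (x ℕ.+ y) → Fin (x ℕ.+ y)
    rotate   k = cast y+x≡x+y (join y x (Sum.swap (splitAt x k)))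
    unrotate k = join x y (Sum.swap (splitAt y (cast x+y≡y+x k)))

    unrotate-rotate : ∀ k → unrotate (rotate k) ≡ k
    unrotate-rotate k = begin
        join x y (Sum.swap (splitAt y (cast x+y≡y+x (rotate k))))
      ≡⟨ cong (join x y ∘ Sum.swap ∘ splitAt y) (FinP.cast-involutive x+y≡y+x y+x≡x+y _) ⟩
        join x y (Sum.swap (splitAt y (join y x (Sum.swap (splitAt x k)))))
      ≡⟨ cong (join x y ∘ Sum.swap) (FinP.splitAt-join y x (Sum.swap (splitAt x k))) ⟩
        join x y (Sum.swap (Sum.swap (splitAt x k)))
      ≡⟨ cong (join x y) (SumP.swap-involutive (splitAt x k)) ⟩
        join x y (splitAt x k)
      ≡⟨ FinP.join-splitAt x y k ⟩
        k ∎
      where open ≡-Reasoning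

    rotate-unrotate : ∀ k → rotate (unrotate k) ≡ k
    rotate-unrotate k = begin
        cast y+x≡x+y (join y x (Sum.swap (splitAt x (join x y (Sum.swap (splitAt y k′))))))
      ≡⟨ cong (cast y+x≡x+y ∘ join y x ∘ Sum.swap) (FinP.splitAt-join x y (Sum.swap (splitAt y k′))) ⟩
        cast y+x≡x+y (join y x (Sum.swap (Sum.swap (splitAt y k′))))
      ≡⟨ cong (cast y+x≡x+y ∘ join y x) (SumP.swap-involutive (splitAt y k′)) ⟩
        cast y+x≡x+y (join y x (splitAt y k′))
      ≡⟨ cong (cast y+x≡x+y) (FinP.join-splitAt y x k′) ⟩
        cast y+x≡x+y k′
      ≡⟨ FinP.cast-involutive y+x≡x+y x+y≡y+x k ⟩
        k ∎
      where
      open ≡-Reasoning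
      k′ : Fin (y ℕ.+ x)
      k′ = cast x+y≡y+x k

    toℕ-rotate-↑ˡ : ∀ i → toℕ (rotate (i ↑ˡ y)) ≡ y ℕ.+ toℕ i
    toℕ-rotate-↑ˡ i rewrite FinP.splitAt-↑ˡ x i y = trans (FinP.toℕ-cast y+x≡x+y (y ↑ʳ i)) (FinP.toℕ-↑ʳ y i)

    rotate-invertible : Invertible (x ℕ.+ y) (perm rotate)
    rotate-invertible = perm-invertible unrotate-rotate rotate-unrotate

    [I∣𝟘]⊗rotate : [ I x ∣ 𝟘 {x} {y} ] ⊗ perm rotate ≃ₘ ZeroI (x ℕ.+ y) x
    [I∣𝟘]⊗rotate = begin
        [ I x ∣ 𝟘 ] ⊗ perm rotate
      ≈⟨ [∣]-⊗ (I x) 𝟘 (perm rotate) ⟩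
        I x ⊗ top ⊕ 𝟘 ⊗ (λ t → perm rotate (x ↑ʳ t))
      ≈⟨ ⊕-cong (⊗-identityˡ top) (⊗-zeroˡ (λ t → perm rotate (x ↑ʳ t))) ⟩
        top ⊕ 𝟘
      ≈⟨ ⊕-identityʳ top ⟩
        top
      ≈⟨ ≡⇒≃ₘ (λ i j → trans (I-δ _ (rotate (i ↑ˡ y)) j)
                     (trans (cong (δ (toℕ j)) (trans (toℕ-rotate-↑ˡ i) (cong (ℕ._+ toℕ i) (sym (ℕP.m+n∸m≡n x y)))))
                            (sym (ZeroI-δ _ x i j)))) ⟩
        ZeroI (x ℕ.+ y) x ∎
      where
      open SetoidReasoning (≃ₘ-setoid x (x ℕ.+ y))
      top : Matrix x (x ℕ.+ y)
      top i = perm rotate (i ↑ˡ y)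

  Diag-unit⇒[I∣𝟘] : ∀ x y r e → (∀ (i : Fin x) → Σ (toℕ i ℕ.< r) λ i<r → e (fromℕ< i<r) ≡ 0) →
    Diag x (x ℕ.+ y) r e ≃ₘ [ I x ∣ 𝟘 {x} {y} ]
  Diag-unit⇒[I∣𝟘] x y r e unit-diag i = splitAt-elim x y _
    (λ j → ≃-reflexive (trans (cong (Dentry r e (toℕ i)) (FinP.toℕ-↑ˡ j y))
                       (trans (left j (i FinP.≟ j)) (sym ([∣]-↑ˡ (I x) 𝟘 i j)))))
    (λ j → ≃-reflexive (trans (Dentry-off r e (toℕ i) _ (i≢x+j j)) (sym ([∣]-↑ʳ (I x) (𝟘 {x} {y}) i j))))
    where
    left : ∀ j → Dec (i ≡ j) → Dentry r e (toℕ i) (toℕ j) ≡ I x i j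
    left j (yes refl) = trans (Dentry-diag r e (toℕ i) (proj₁ (unit-diag i)))
                              (trans (cong p^_ (proj₂ (unit-diag i))) (sym (I-diag x i)))
    left j (no  i≢j)  = trans (Dentry-off r e (toℕ i) (toℕ j) (i≢j ∘ FinP.toℕ-injective)) (sym (I-off x i j i≢j))
    i≢x+j : ∀ j → toℕ i ≢ toℕ (x ↑ʳ j)
    i≢x+j j eq = ℕP.<⇒≢ (ℕP.<-≤-trans (FinP.toℕ<n i) (ℕP.m≤m+n x (toℕ j))) (trans eq (FinP.toℕ-↑ʳ x j))

  equivalent-right-inverse : ∀ {x N} {L : Matrix x x} {M : Matrix x N} {R : Matrix N N} {D : Matrix x N}
    (L-inv : Invertible x L) (R-inv : Invertible N R) (Z : Matrix N x) c (G : Matrix x x) →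
    (L ⊗ M) ⊗ R ≃ₘ D → M ⊗ Z ≃ₘ I x ⊕ c ·ₘ G →
    D ⊗ ((inverse R-inv ⊗ Z) ⊗ inverse L-inv) ≃ₘ I x ⊕ c ·ₘ ((L ⊗ G) ⊗ inverse L-inv)
  equivalent-right-inverse {x} {N} {L} {M} {R} {D} (invertible L′ LL′ _) (invertible R′ RR′ _) Z c G LMR≃D MZ≃I+cG =
    begin
      D ⊗ ((R′ ⊗ Z) ⊗ L′)
    ≈⟨ ⊗-congˡ _ (≃ₘ-sym LMR≃D) ⟩
      ((L ⊗ M) ⊗ R) ⊗ ((R′ ⊗ Z) ⊗ L′)
    ≈⟨ ⊗-assoc (L ⊗ M) R _ ⟩
      (L ⊗ M) ⊗ (R ⊗ ((R′ ⊗ Z) ⊗ L′))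
    ≈⟨ ⊗-congʳ (L ⊗ M) (≃ₘ-trans (⊗-congʳ R (⊗-assoc R′ Z L′)) (cancelˡ R R′ (Z ⊗ L′) RR′)) ⟩
      (L ⊗ M) ⊗ (Z ⊗ L′)
    ≈⟨ ≃ₘ-trans (⊗-assoc L M (Z ⊗ L′)) (⊗-congʳ L (≃ₘ-sym (⊗-assoc M Z L′))) ⟩
      L ⊗ ((M ⊗ Z) ⊗ L′)
    ≈⟨ ⊗-congʳ L (⊗-congˡ L′ MZ≃I+cG) ⟩
      L ⊗ ((I x ⊕ c ·ₘ G) ⊗ L′)
    ≈⟨ ⊗-congʳ L (≃ₘ-trans (⊗-distribʳ-⊕ L′ (I x) (c ·ₘ G)) (⊕-cong (⊗-identityˡ L′) (·ₘ-assoc-⊗ c G L′))) ⟩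
      L ⊗ (L′ ⊕ c ·ₘ (G ⊗ L′))
    ≈⟨ ≃ₘ-trans (⊗-distribˡ-⊕ L L′ (c ·ₘ (G ⊗ L′))) (⊕-cong LL′ (⊗-·ₘ-comm L c (G ⊗ L′))) ⟩
      I x ⊕ c ·ₘ (L ⊗ (G ⊗ L′))
    ≈⟨ ⊕-cong (≃ₘ-refl {A = I x}) (λ i j → *-cong (≃-refl {c}) (≃ₘ-sym (⊗-assoc L G L′) i j)) ⟩
      I x ⊕ c ·ₘ ((L ⊗ G) ⊗ L′) ∎
    where open SetoidReasoning (≃ₘ-setoid x x)

  [I∣𝟘]⊗block : ∀ x y (L : Matrix x x) →
    [ I x ∣ 𝟘 {x} {y} ] ⊗ block L 𝟘 𝟘 (I y) ≃ₘ L ⊗ [ I x ∣ 𝟘 {x} {y} ]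
  [I∣𝟘]⊗block x y L = begin
      [ I x ∣ 𝟘 ] ⊗ block L 𝟘 𝟘 (I y)
    ≈⟨ [∣]-⊗-block (I x) 𝟘 L 𝟘 𝟘 (I y) ⟩
      [ I x ⊗ L ⊕ 𝟘 ⊗ 𝟘 {y} ∣ I x ⊗ 𝟘 ⊕ 𝟘 ⊗ I y ]
    ≈⟨ [∣]-cong (≃ₘ-trans (⊕-cong (⊗-identityˡ L) (⊗-zeroˡ {l = y} (𝟘 {y} {x}))) (⊕-identityʳ L))
                (≃ₘ-trans (⊕-cong (⊗-identityˡ 𝟘) (⊗-zeroˡ (I y))) (⊕-identityˡ 𝟘)) ⟩
      [ L ∣ 𝟘 ]
    ≈⟨ ≃ₘ-sym (≃ₘ-trans (⊗-[∣] L (I x) 𝟘) ([∣]-cong (⊗-identityʳ L) (⊗-zeroʳ L))) ⟩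
      L ⊗ [ I x ∣ 𝟘 ] ∎
    where open SetoidReasoning (≃ₘ-setoid x (x ℕ.+ y))

  record Completion {x N} (M : Matrix x N) : Set where
    field
      Y            : Matrix N N
      Y-invertible : Invertible N Y
      MY≃ZeroI     : M ⊗ Y ≃ₘ ZeroI N x

  module _ (p-prime : Prime p) where

    coprime-p^ : ∀ {a} → ¬ (p ℕD.∣ a) → ∀ k → Coprime a (p ^ k)
    coprime-p^ p∤a zero    (d∣a , d∣1)   = ℕD.∣1⇒≡1 d∣1
    coprime-p^ p∤a (suc k) (d∣a , d∣p^1+k) = coprime-p^ p∤a k (d∣a , coprime-divisor d⊥p d∣p^1+k)
      where
      d⊥p : Coprime _ p
      d⊥p (e∣d , e∣p) with prime⇒irreducible p-prime e∣p
      ... | inj₁ e≡1    = e≡1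
      ... | inj₂ refl = ⊥-elim (p∤a (ℕD.∣-trans e∣d d∣a))

    pos-1+*≡* : ∀ b c d a → 1 ℕ.+ b ℕ.* c ≡ d ℕ.* a → 1ℤ + + b * + c ≡ + d * + a
    pos-1+*≡* b c d a eq =
      trans (cong (_+_ 1ℤ) (sym (ℤP.pos-* b c)))
            (trans (sym (ℤP.pos-+ 1 (b ℕ.* c))) (trans (cong +_ eq) (ℤP.pos-* d a)))

    p∤⇒unitᴺ : ∀ a → ¬ (p ℕD.∣ a) → ∃[ w ] + a * w ≃ 1ℤ
    p∤⇒unitᴺ a p∤a with coprime-Bézout (coprime-p^ p∤a s)
    ... | Bézout.+- x y 1+yq≡xa = + x , ≡+*q⇒≃ (+ y) (sym (trans (pos-1+*≡* y q x a 1+yq≡xa) (ℤP.*-comm (+ x) (+ a))))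
    ... | Bézout.-+ x y 1+xa≡yq = - + x , ≡+*q⇒≃ (- + y) (negate (+ a) (+ x) (+ y) qℤ (pos-1+*≡* x a y q 1+xa≡yq))
      where
      negate : ∀ a x y q → 1ℤ + x * a ≡ y * q → a * - x ≡ 1ℤ + - y * q
      negate a x y q eq = trans (rearrange a x) (trans (cong (_-_ 1ℤ) eq) (rearrange′ y q))
        where
        rearrange : ∀ a x → a * - x ≡ 1ℤ - (1ℤ + x * a)
        rearrange = solve-∀
        rearrange′ : ∀ y q → 1ℤ - y * q ≡ 1ℤ + - y * q
        rearrange′ = solve-∀

    p∤⇒unit : ∀ u → ¬ (pℤ ℤD.∣ u) → ∃[ w ] u * w ≃ 1ℤ
    p∤⇒unit (+ a)    p∤u = p∤⇒unitᴺ a (p∤u ∘ ℤD.∣ᵤ⇒∣)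
    p∤⇒unit -[1+ n ] p∤u with p∤⇒unitᴺ (suc n) (p∤u ∘ ℤD.∣ᵤ⇒∣)
    ... | w , aw≃1 = - w , ≃-trans (≃-reflexive (neg*neg (+ suc n) w)) aw≃1
      where
      neg*neg : ∀ a w → - a * - w ≡ a * w
      neg*neg = solve-∀

    record Pivoted {m a} (M : Matrix (suc m) (suc a)) (c : ℕ) : Set where
      field
        L            : Matrix (suc m) (suc m)
        L-invertible : Invertible (suc m) L
        R            : Matrix (suc a) (suc a)
        R-invertible : Invertible (suc a) R
        rest         : Matrix m a
        LMR≃corner   : (L ⊗ M) ⊗ R ≃ₘ corner (p^ c) (p^ c ·ₘ rest)

    pivot : ∀ {m a} c (M N : Matrix (suc m) (suc a)) → M ≃ₘ p^ c ·ₘ N →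
      ∀ i₀ j₀ → ¬ (pℤ ℤD.∣ N i₀ j₀) → Pivoted M c
    pivot {m} {a} c M N M≃p^cN i₀ j₀ p∤N₀ = record
      { L = L ⊗ perm σ
      ; L-invertible = ⊗-invertible L-invertible (transpose-invertible fzero i₀)
      ; R = perm τ⁻¹ ⊗ R
      ; R-invertible = ⊗-invertible (transpose-invertible j₀ fzero) R-invertible
      ; rest = complement
      ; LMR≃corner = begin
          ((L ⊗ perm σ) ⊗ M) ⊗ (perm τ⁻¹ ⊗ R)  ≈⟨ sandwich-assoc L (perm σ) M (perm τ⁻¹) R ⟩
          (L ⊗ ((perm σ ⊗ M) ⊗ perm τ⁻¹)) ⊗ R  ≈⟨ ⊗-congˡ R (⊗-congʳ L swapped) ⟩
          (L ⊗ (p^ c ·ₘ N₁)) ⊗ R                ≈⟨ ·ₘ-sandwich L (p^ c) N₁ R ⟩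
          p^ c ·ₘ ((L ⊗ N₁) ⊗ R)                ≈⟨ (λ i j → *-cong (≃-refl {p^ c}) (eliminate i j)) ⟩
          p^ c ·ₘ corner 1ℤ complement          ≈⟨ ·ₘ-corner-1 (p^ c) complement ⟩
          corner (p^ c) (p^ c ·ₘ complement)    ∎
      }
      where
      σ : Fin (suc m) → Fin (suc m)
      σ = transpose fzero i₀
      τ τ⁻¹ : Fin (suc a) → Fin (suc a)
      τ   = transpose fzero j₀
      τ⁻¹ = transpose j₀ fzero
      N₁ : Matrix (suc m) (suc a)
      N₁ i j = N (σ i) (τ j)
      open Elimination N₁ (proj₁ (p∤⇒unit (N i₀ j₀) p∤N₀)) (proj₂ (p∤⇒unit (N i₀ j₀) p∤N₀))
      open SetoidReasoning (≃ₘ-setoid (suc m) (suc a))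
      swapped : (perm σ ⊗ M) ⊗ perm τ⁻¹ ≃ₘ p^ c ·ₘ N₁
      swapped = ≃ₘ-trans (⊗-perm {σ = τ⁻¹} {τ = τ} (λ _ → transpose-inverse fzero j₀) (λ _ → transpose-inverse j₀ fzero)
                                 (perm σ ⊗ M))
                         (λ i j → ≃-trans (perm-⊗ σ M i (τ j)) (M≃p^cN (σ i) (τ j)))

    record SmithForm {m a} (M : Matrix m a) (c : ℕ) : Set where
      field
        L             : Matrix m m
        L-invertible  : Invertible m L
        R             : Matrix a a
        R-invertible  : Invertible a R
        rank          : ℕ
        rank≤m        : rank ℕ.≤ m
        rank≤a        : rank ℕ.≤ a
        exponent      : Fin rank → ℕ
        exponent-mono : ∀ x y → x ≤ᶠ y → exponent x ℕ.≤ exponent y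
        c≤exponent    : ∀ x → c ℕ.≤ exponent x
        exponent<s    : ∀ x → exponent x ℕ.< s
        LMR≃Diag      : (L ⊗ M) ⊗ R ≃ₘ Diag m a rank exponent

    smith-zero : ∀ {m a} (M : Matrix m a) c → M ≃ₘ 𝟘 → SmithForm M c
    smith-zero {m} {a} M c M≃0 = record
      { L = I m ; L-invertible = I-invertible m ; R = I a ; R-invertible = I-invertible a
      ; rank = 0 ; rank≤m = z≤n ; rank≤a = z≤n ; exponent = λ ()
      ; exponent-mono = λ () ; c≤exponent = λ () ; exponent<s = λ ()
      ; LMR≃Diag = ≃ₘ-trans (⊗-congˡ (I a) (⊗-identityˡ M))
                   (≃ₘ-trans (⊗-identityʳ M) (≃ₘ-trans M≃0 (≃ₘ-sym (Diag-zero m a (λ ())))))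
      }

    smith-lower : ∀ {m a} {M : Matrix m a} {c c′} → c′ ℕ.≤ c → SmithForm M c → SmithForm M c′
    smith-lower c′≤c S = record
      { L = L ; L-invertible = L-invertible ; R = R ; R-invertible = R-invertible
      ; rank = rank ; rank≤m = rank≤m ; rank≤a = rank≤a ; exponent = exponent
      ; exponent-mono = exponent-mono ; c≤exponent = λ x → ℕP.≤-trans c′≤c (c≤exponent x)
      ; exponent<s = exponent<s ; LMR≃Diag = LMR≃Diag }
      where open SmithForm S

    smith-extend : ∀ {m a} {M : Matrix (suc m) (suc a)} {c} → c ℕ.< s →
      (P : Pivoted M c) → SmithForm (p^ c ·ₘ Pivoted.rest P) c → SmithForm M c
    smith-extend {m} {a} {M} {c} c<s P S = record
      { L = corner 1ℤ S.L ⊗ P.L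
      ; L-invertible = ⊗-invertible (corner-1-invertible S.L-invertible) P.L-invertible
      ; R = P.R ⊗ corner 1ℤ S.R
      ; R-invertible = ⊗-invertible P.R-invertible (corner-1-invertible S.R-invertible)
      ; rank = suc S.rank ; rank≤m = s≤s S.rank≤m ; rank≤a = s≤s S.rank≤a
      ; exponent = c ∷ᵉ S.exponent
      ; exponent-mono = mono ; c≤exponent = lower ; exponent<s = upper
      ; LMR≃Diag = begin
          ((corner 1ℤ S.L ⊗ P.L) ⊗ M) ⊗ (P.R ⊗ corner 1ℤ S.R)
        ≈⟨ sandwich-assoc (corner 1ℤ S.L) P.L M P.R (corner 1ℤ S.R) ⟩
          (corner 1ℤ S.L ⊗ ((P.L ⊗ M) ⊗ P.R)) ⊗ corner 1ℤ S.R
        ≈⟨ ⊗-congˡ (corner 1ℤ S.R) (⊗-congʳ (corner 1ℤ S.L) P.LMR≃corner) ⟩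
          (corner 1ℤ S.L ⊗ corner (p^ c) (p^ c ·ₘ P.rest)) ⊗ corner 1ℤ S.R
        ≈⟨ ⊗-congˡ (corner 1ℤ S.R) (corner-⊗ 1ℤ (p^ c) S.L (p^ c ·ₘ P.rest)) ⟩
          corner (1ℤ * p^ c) (S.L ⊗ (p^ c ·ₘ P.rest)) ⊗ corner 1ℤ S.R
        ≈⟨ corner-⊗ (1ℤ * p^ c) 1ℤ (S.L ⊗ (p^ c ·ₘ P.rest)) S.R ⟩
          corner (1ℤ * p^ c * 1ℤ) ((S.L ⊗ (p^ c ·ₘ P.rest)) ⊗ S.R)
        ≈⟨ corner-cong (≃-reflexive (trans (ℤP.*-identityʳ _) (ℤP.*-identityˡ (p^ c)))) S.LMR≃Diag ⟩
          corner (p^ c) (Diag m a S.rank S.exponent)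
        ≈⟨ ≃ₘ-sym (Diag-suc m a S.rank c S.exponent) ⟩
          Diag (suc m) (suc a) (suc S.rank) (c ∷ᵉ S.exponent) ∎
      }
      where
      module P = Pivoted P
      module S = SmithForm S
      open SetoidReasoning (≃ₘ-setoid (suc m) (suc a))
      mono : ∀ x y → x ≤ᶠ y → (c ∷ᵉ S.exponent) x ℕ.≤ (c ∷ᵉ S.exponent) y
      mono fzero    fzero    _       = ℕP.≤-refl
      mono fzero    (fsuc y) _       = S.c≤exponent y
      mono (fsuc x) (fsuc y) (s≤s x≤y) = S.exponent-mono x y x≤y
      lower : ∀ x → c ℕ.≤ (c ∷ᵉ S.exponent) x
      lower fzero    = ℕP.≤-refl
      lower (fsuc x) = S.c≤exponent x
      upper : ∀ x → (c ∷ᵉ S.exponent) x ℕ.< s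
      upper fzero    = c<s
      upper (fsuc x) = S.exponent<s x

    -- Fuel d with d + c = s: either every entry of N is divisible by p (c grows), or a pivot exists (m shrinks).
    smith-go : ∀ m a d c → d ℕ.+ c ≡ s → (M N : Matrix m a) → M ≃ₘ p^ c ·ₘ N → SmithForm M c
    smith-go zero    a       d       c _ M N _ = smith-zero M c λ ()
    smith-go (suc m) zero    d       c _ M N _ = smith-zero M c λ _ ()
    smith-go (suc m) (suc a) zero    c refl M N M≃p^sN =
      smith-zero M c λ i j → ≃-trans (M≃p^sN i j) (p^s*≃0 (N i j))
    smith-go (suc m) (suc a) (suc d) c d+c≡s M N M≃p^cN
      with FinP.all? (λ i → FinP.all? (λ j → pℤ ℤD.∣? N i j))
    ... | yes p∣N = smith-lower (ℕP.n≤1+n c) S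
      where
      N′ : Matrix (suc m) (suc a)
      N′ i j = ℤD.quotient (p∣N i j)
      M≃p^1+cN′ : M ≃ₘ p^ suc c ·ₘ N′
      M≃p^1+cN′ i j = ≃-trans (M≃p^cN i j) (≃-reflexive (begin
          p^ c * N i j          ≡⟨ cong (p^ c *_) (trans (ℤD._∣_.equality (p∣N i j)) (ℤP.*-comm (N′ i j) pℤ)) ⟩
          p^ c * (pℤ * N′ i j)  ≡⟨ sym (ℤP.*-assoc (p^ c) pℤ (N′ i j)) ⟩
          p^ c * pℤ * N′ i j    ≡⟨ cong (_* N′ i j) (trans (ℤP.*-comm (p^ c) pℤ) (sym (p^-suc c))) ⟩
          p^ suc c * N′ i j     ∎))
        where open ≡-Reasoning
      S : SmithForm M (suc c)
      S = smith-go (suc m) (suc a) d (suc c) (trans (ℕP.+-suc d c) d+c≡s) M N′ M≃p^1+cN′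
    ... | no ¬p∣N with FinP.¬∀⟶∃¬ (suc m) _ (λ i → FinP.all? (λ j → pℤ ℤD.∣? N i j)) ¬p∣N
    ...   | i₀ , ¬p∣Nᵢ₀ with FinP.¬∀⟶∃¬ (suc a) _ (λ j → pℤ ℤD.∣? N i₀ j) ¬p∣Nᵢ₀
    ...     | j₀ , p∤N₀ = smith-extend c<s P (smith-go m a (suc d) c d+c≡s _ (Pivoted.rest P) ≃ₘ-refl)
      where
      P : Pivoted M c
      P = pivot c M N M≃p^cN i₀ j₀ p∤N₀
      c<s : c ℕ.< s
      c<s = subst (c ℕ.<_) d+c≡s (ℕP.m<n+m c (s≤s z≤n))

    smith : ∀ {m a} (M : Matrix m a) → SmithForm M 0
    smith {m} {a} M = smith-go m a s 0 (ℕP.+-identityʳ s) M M (λ i j → ≃-reflexive (sym (ℤP.*-identityˡ (M i j))))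

    module _ (1≤s : 1 ℕ.≤ s) where

      qℤ≡pℤ*p^[s-1] : qℤ ≡ pℤ * p^ (s ∸ 1)
      qℤ≡pℤ*p^[s-1] = trans (cong p^_ (sym (ℕP.m+[n∸m]≡n 1≤s))) (p^-suc (s ∸ 1))

      p*≄1+p* : ∀ y z → ¬ (pℤ * y ≃ 1ℤ + pℤ * z)
      p*≄1+p* y z py≃1+pz with ≃⇒≡+*q py≃1+pz
      ... | t , py≡1+pz+tq = p≢1 (ℕD.∣1⇒≡1 (ℤD.∣⇒∣ᵤ (ℤD.divides (y - z - t * p^ (s ∸ 1)) 1≡[y-z-tp^[s-1]]p)))
        where
        p≢1 : p ≢ 1
        p≢1 = nonTrivial⇒≢1 {{prime⇒nonTrivial p-prime}}
        isolate : ∀ p y z t p′ → p * y ≡ 1ℤ + p * z + t * (p * p′) → 1ℤ ≡ (y - z - t * p′) * p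
        isolate p y z t p′ eq =
          trans (rearrange p z t p′) (trans (cong (λ v → v - p * z - t * (p * p′)) (sym eq)) (factor p y z t p′))
          where
          rearrange : ∀ p z t p′ → 1ℤ ≡ (1ℤ + p * z + t * (p * p′)) - p * z - t * (p * p′)
          rearrange = solve-∀
          factor : ∀ p y z t p′ → p * y - p * z - t * (p * p′) ≡ (y - z - t * p′) * p
          factor = solve-∀
        1≡[y-z-tp^[s-1]]p : 1ℤ ≡ (y - z - t * p^ (s ∸ 1)) * pℤ
        1≡[y-z-tp^[s-1]]p =
          isolate pℤ y z t (p^ (s ∸ 1)) (trans py≡1+pz+tq (cong (λ v → 1ℤ + pℤ * z + t * v) qℤ≡pℤ*p^[s-1]))

      -- A diagonal entry that is 0 or a multiple of p would make (D V)ᵢᵢ ≡ 0 modulo p instead of 1.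
      Diag-unit-mod-p : ∀ {x N r e} → r ℕ.≤ N → (V : Matrix N x) (G : Matrix x x) →
        Diag x N r e ⊗ V ≃ₘ I x ⊕ pℤ ·ₘ G → ∀ (i : Fin x) → Σ (toℕ i ℕ.< r) λ i<r → e (fromℕ< i<r) ≡ 0
      Diag-unit-mod-p {x} {N} {r} {e} r≤N V G DV≃I+pG i = by-cases (toℕ i <? r)
        where
        DVᵢᵢ≢p* : ∀ y → (Diag x N r e ⊗ V) i i ≢ pℤ * y
        DVᵢᵢ≢p* y DVᵢᵢ≡py = p*≄1+p* y (G i i)
          (≃-trans (≃-reflexive (sym DVᵢᵢ≡py)) (≃-trans (DV≃I+pG i i) (≃-reflexive (cong (_+ pℤ * G i i) (I-diag x i)))))
        by-cases : Dec (toℕ i ℕ.< r) → Σ (toℕ i ℕ.< r) λ i<r → e (fromℕ< i<r) ≡ 0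
        by-cases (no  i≮r) = ⊥-elim (DVᵢᵢ≢p* 0ℤ DVᵢᵢ≡0)
          where
          DVᵢᵢ≡0 : (Diag x N r e ⊗ V) i i ≡ pℤ * 0ℤ
          DVᵢᵢ≡0 = trans (sumF-zero N (λ l → trans (cong (_* V l i) (Dentry-beyond r e (toℕ i) (toℕ l) (ℕP.≮⇒≥ i≮r)))
                                                    (ℤP.*-zeroˡ (V l i))))
                         (sym (ℤP.*-zeroʳ pℤ))
        by-cases (yes i<r) with e (fromℕ< i<r) in eᵢ≡
        ... | zero  = i<r , refl
        ... | suc k = ⊥-elim (DVᵢᵢ≢p* (p^ k * V l₀ i) DVᵢᵢ≡p*)
          where
          i<N : toℕ i ℕ.< N
          i<N = ℕP.<-≤-trans i<r r≤N
          l₀ : Fin N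
          l₀ = fromℕ< i<N
          DVᵢᵢ≡p* : (Diag x N r e ⊗ V) i i ≡ pℤ * (p^ k * V l₀ i)
          DVᵢᵢ≡p* = begin
              (Diag x N r e ⊗ V) i i
            ≡⟨ sumF-single N _ (toℕ i) i<N (λ l l≢i → trans (cong (_* V l i) (Dentry-off r e (toℕ i) (toℕ l) (l≢i ∘ sym)))
                                                              (ℤP.*-zeroˡ (V l i))) ⟩
              Dentry r e (toℕ i) (toℕ l₀) * V l₀ i
            ≡⟨ cong (λ j → Dentry r e (toℕ i) j * V l₀ i) (FinP.toℕ-fromℕ< i<N) ⟩
              Dentry r e (toℕ i) (toℕ i) * V l₀ i
            ≡⟨ cong (_* V l₀ i) (trans (Dentry-diag r e (toℕ i) i<r) (cong p^_ eᵢ≡)) ⟩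
              p^ suc k * V l₀ i
            ≡⟨ trans (cong (_* V l₀ i) (p^-suc k)) (ℤP.*-assoc pℤ (p^ k) (V l₀ i)) ⟩
              pℤ * (p^ k * V l₀ i) ∎
            where open ≡-Reasoning

      complete : ∀ {x N} y → x ℕ.+ y ≡ N → (M : Matrix x N) (Z : Matrix N x) (G : Matrix x x) →
        M ⊗ Z ≃ₘ I x ⊕ pℤ ·ₘ G → Completion M
      complete {x} y refl M Z G MZ≃I+pG = record
        { Y = (R ⊗ block L 𝟘 𝟘 (I y)) ⊗ perm rotate
        ; Y-invertible = ⊗-invertible (⊗-invertible R-invertible (block-upper-invertible 𝟘 L-invertible (I-invertible y)))
                                      rotate-invertible
        ; MY≃ZeroI = begin
            M ⊗ ((R ⊗ block L 𝟘 𝟘 (I y)) ⊗ perm rotate)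
          ≈⟨ ≃ₘ-sym (≃ₘ-trans (⊗-congˡ (perm rotate) (⊗-assoc M R (block L 𝟘 𝟘 (I y))))
                              (⊗-assoc M (R ⊗ block L 𝟘 𝟘 (I y)) (perm rotate))) ⟩
            ((M ⊗ R) ⊗ block L 𝟘 𝟘 (I y)) ⊗ perm rotate
          ≈⟨ ⊗-congˡ (perm rotate) (⊗-congˡ (block L 𝟘 𝟘 (I y)) MR≃L⁻¹[I∣𝟘]) ⟩
            ((L⁻¹ ⊗ [ I x ∣ 𝟘 ]) ⊗ block L 𝟘 𝟘 (I y)) ⊗ perm rotate
          ≈⟨ ⊗-congˡ (perm rotate) (≃ₘ-trans (⊗-assoc L⁻¹ [ I x ∣ 𝟘 ] (block L 𝟘 𝟘 (I y)))
                                   (≃ₘ-trans (⊗-congʳ L⁻¹ ([I∣𝟘]⊗block x y L))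
                                             (cancelˡ L⁻¹ L [ I x ∣ 𝟘 ] (inverseˡ L-invertible)))) ⟩
            [ I x ∣ 𝟘 ] ⊗ perm rotate
          ≈⟨ [I∣𝟘]⊗rotate ⟩
            ZeroI (x ℕ.+ y) x ∎
        }
        where
        open SmithForm (smith M)
        open Rotation x y
        open SetoidReasoning (≃ₘ-setoid x (x ℕ.+ y))
        L⁻¹ : Matrix x x
        L⁻¹ = inverse L-invertible
        D≃[I∣𝟘] : Diag x (x ℕ.+ y) rank exponent ≃ₘ [ I x ∣ 𝟘 ]
        D≃[I∣𝟘] = Diag-unit⇒[I∣𝟘] x y rank exponent (Diag-unit-mod-p rank≤a _ _
                    (equivalent-right-inverse L-invertible R-invertible Z pℤ G LMR≃Diag MZ≃I+pG))
        MR≃L⁻¹[I∣𝟘] : M ⊗ R ≃ₘ L⁻¹ ⊗ [ I x ∣ 𝟘 ]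
        MR≃L⁻¹[I∣𝟘] = ≃ₘ-trans (≃ₘ-sym (cancelˡ L⁻¹ L (M ⊗ R) (inverseˡ L-invertible)))
                                (⊗-congʳ L⁻¹ (≃ₘ-trans (≃ₘ-sym (⊗-assoc L M R)) (≃ₘ-trans LMR≃Diag D≃[I∣𝟘])))

      unimodular⇒ZeroI : ∀ a k (A : Matrix k (a ℕ.+ k)) → Unimodular A → Completion A
      unimodular⇒ZeroI a k A (X , AX≋I) = complete a (ℕP.+-comm k a) A X 𝟘 (≋I⇒≃I⊕p𝟘 AX≋I)

      module Reduction (a k m : ℕ) (m≤k : m ℕ.≤ k) (A : Matrix k (a ℕ.+ k)) (B : Matrix m (a ℕ.+ k))
                       (A-unimodular : Unimodular A) (B-unimodular : Unimodular B) where

        open Completion (unimodular⇒ZeroI a k A A-unimodular)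
          renaming (Y to W₁; Y-invertible to W₁-invertible; MY≃ZeroI to AW₁≃ZeroI)

        B₁ : Matrix m a
        B₁ i j = (B ⊗ W₁) i (j ↑ˡ k)

        B₂ : Matrix m k
        B₂ i j = (B ⊗ W₁) i (a ↑ʳ j)

        open SmithForm (smith B₁) public
          renaming (L to L₁; L-invertible to L₁-invertible; R to R₁; R-invertible to R₁-invertible)

        D : Matrix m a
        D = Diag m a rank exponent

        C : Matrix m k
        C = L₁ ⊗ B₂

        W₃ : Matrix (a ℕ.+ k) (a ℕ.+ k)
        W₃ = block R₁ 𝟘 𝟘 (I k)

        W₁₃-invertible : Invertible (a ℕ.+ k) (W₁ ⊗ W₃)
        W₁₃-invertible = ⊗-invertible W₁-invertible (block-upper-invertible 𝟘 R₁-invertible (I-invertible k))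

        B≃[D∣C] : (L₁ ⊗ B) ⊗ (W₁ ⊗ W₃) ≃ₘ [ D ∣ C ]
        B≃[D∣C] = begin
            (L₁ ⊗ B) ⊗ (W₁ ⊗ W₃)
          ≈⟨ ≃ₘ-trans (≃ₘ-sym (⊗-assoc (L₁ ⊗ B) W₁ W₃)) (⊗-congˡ W₃ (⊗-assoc L₁ B W₁)) ⟩
            (L₁ ⊗ (B ⊗ W₁)) ⊗ W₃
          ≈⟨ ⊗-congˡ W₃ (⊗-congʳ L₁ (λ i → splitAt-elim a k _
                (λ j → ≃-reflexive (sym ([∣]-↑ˡ B₁ B₂ i j))) (λ j → ≃-reflexive (sym ([∣]-↑ʳ B₁ B₂ i j))))) ⟩
            (L₁ ⊗ [ B₁ ∣ B₂ ]) ⊗ W₃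
          ≈⟨ ⊗-congˡ W₃ (⊗-[∣] L₁ B₁ B₂) ⟩
            [ L₁ ⊗ B₁ ∣ C ] ⊗ W₃
          ≈⟨ [∣]-⊗-block (L₁ ⊗ B₁) C R₁ 𝟘 𝟘 (I k) ⟩
            [ (L₁ ⊗ B₁) ⊗ R₁ ⊕ C ⊗ 𝟘 ∣ (L₁ ⊗ B₁) ⊗ 𝟘 ⊕ C ⊗ I k ]
          ≈⟨ [∣]-cong (≃ₘ-trans (⊕-cong LMR≃Diag (⊗-zeroʳ C)) (⊕-identityʳ D))
                      (≃ₘ-trans (⊕-cong (⊗-zeroʳ (L₁ ⊗ B₁)) (⊗-identityʳ C)) (⊕-identityˡ C)) ⟩
            [ D ∣ C ] ∎
          where open SetoidReasoning (≃ₘ-setoid m (a ℕ.+ k))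

        open ZeroPrefix (zero-prefix rank exponent exponent-mono) renaming (length to t; length≤r to t≤rank)

        t≤m : t ℕ.≤ m
        t≤m = ℕP.≤-trans t≤rank rank≤m

        m′ : ℕ
        m′ = m ∸ t

        lower : Fin m′ → Fin m
        lower i′ = cast (ℕP.m+[n∸m]≡n t≤m) (t ↑ʳ i′)

        toℕ-lower : ∀ i′ → toℕ (lower i′) ≡ t ℕ.+ toℕ i′
        toℕ-lower i′ = trans (FinP.toℕ-cast (ℕP.m+[n∸m]≡n t≤m) (t ↑ʳ i′)) (FinP.toℕ-↑ʳ t i′)

        Z : Matrix (a ℕ.+ k) m
        Z = (inverse W₁₃-invertible ⊗ proj₁ B-unimodular) ⊗ inverse L₁-invertible

        Z₁ : Matrix a m
        Z₁ l = Z (l ↑ˡ k)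

        Z₂ : Matrix k m
        Z₂ l = Z (a ↑ʳ l)

        G₀ : Matrix m m
        G₀ = (L₁ ⊗ 𝟘) ⊗ inverse L₁-invertible

        DZ₁+CZ₂≃I+pG₀ : ∀ i j → (D ⊗ Z₁) i j + (C ⊗ Z₂) i j ≃ I m i j + pℤ * G₀ i j
        DZ₁+CZ₂≃I+pG₀ i j = ≃-trans (≃-sym ([∣]-⊗ D C Z i j))
          (equivalent-right-inverse L₁-invertible W₁₃-invertible (proj₁ B-unimodular) pℤ 𝟘 B≃[D∣C]
                                    (≋I⇒≃I⊕p𝟘 (proj₂ B-unimodular)) i j)

        D-lower-divisible : ∀ i l → t ℕ.≤ toℕ i → ∃[ d ] D i l ≡ pℤ * d
        D-lower-divisible i l t≤i = Dentry-divisible rank exponent (toℕ i) (toℕ l)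
          (λ i<r → positive-above _ (subst (t ℕ.≤_) (sym (FinP.toℕ-fromℕ< i<r)) t≤i))

        t≤lower : ∀ i′ → t ℕ.≤ toℕ (lower i′)
        t≤lower i′ = subst (t ℕ.≤_) (sym (toℕ-lower i′)) (ℕP.m≤m+n t (toℕ i′))

        Dₗ/p : Matrix m′ a
        Dₗ/p i′ l = proj₁ (D-lower-divisible (lower i′) l (t≤lower i′))

        Cₗ : Matrix m′ k
        Cₗ i′ = C (lower i′)

        Zₗ : Matrix k m′
        Zₗ l j′ = Z₂ l (lower j′)

        Gₗ : Matrix m′ m′
        Gₗ i′ j′ = G₀ (lower i′) (lower j′) - sumF a (λ l → Dₗ/p i′ l * Z₁ l (lower j′))

        -- Rows of D below the unit pivots vanish modulo p, so these rows of C stay right invertible modulo p.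
        CₗZₗ≃I+pGₗ : Cₗ ⊗ Zₗ ≃ₘ I m′ ⊕ pℤ ·ₘ Gₗ
        CₗZₗ≃I+pGₗ i′ j′ =
          ≃-trans (isolate (I m i j) (G₀ i j) (DZ₁+CZ₂≃I+pG₀ i j) DZ₁≡p*)
                  (≃-reflexive (cong (_+ pℤ * Gₗ i′ j′) (I-shifted i j i′ j′ t (toℕ-lower i′) (toℕ-lower j′))))
          where
          i j : Fin m
          i = lower i′
          j = lower j′
          DZ₁≡p* : (D ⊗ Z₁) i j ≡ pℤ * sumF a (λ l → Dₗ/p i′ l * Z₁ l j)
          DZ₁≡p* = trans (sumF-cong a λ l → trans (cong (_* Z₁ l j) (proj₂ (D-lower-divisible i l (t≤lower i′))))
                                                   (ℤP.*-assoc pℤ (Dₗ/p i′ l) (Z₁ l j)))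
                         (sumF-*ˡ a pℤ (λ l → Dₗ/p i′ l * Z₁ l j))
          isolate : ∀ {x y w} z g → x + y ≃ z + pℤ * g → x ≡ pℤ * w → y ≃ z + pℤ * (g - w)
          isolate {x} {y} {w} z g x+y≃ refl = ≃-trans (≃-reflexive (rearrange x y))
            (≃-trans (+-cong x+y≃ (≃-refl { - x})) (≃-reflexive (rearrange′ z pℤ g w)))
            where
            rearrange : ∀ x y → y ≡ (x + y) + - x
            rearrange = solve-∀
            rearrange′ : ∀ z p g w → (z + p * g) + - (p * w) ≡ z + p * (g - w)
            rearrange′ = solve-∀

        m′≤k : m′ ℕ.≤ k
        m′≤k = ℕP.≤-trans (ℕP.m∸n≤m m t) m≤k

        open Completion (complete (k ∸ m′) (ℕP.m+[n∸m]≡n m′≤k) Cₗ Zₗ Gₗ CₗZₗ≃I+pGₗ)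
          renaming (MY≃ZeroI to CₗY≃ZeroI)

        T : Matrix m k
        T = ZeroI k m

        pivot-row : (j : Fin a) → toℕ j ℕ.< t → Fin m
        pivot-row j j<t = fromℕ< (ℕP.<-≤-trans j<t t≤m)

        -- X uses the unit pivots of D to turn the first t rows of C Y into those of T.
        X-row : (j : Fin a) → Dec (toℕ j ℕ.< t) → Fin k → ℤ
        X-row j (yes j<t) l = T (pivot-row j j<t) l - (C ⊗ Y) (pivot-row j j<t) l
        X-row j (no  _)   l = 0ℤ

        X : Matrix a k
        X j = X-row j (toℕ j <? t)

        X-pivot : ∀ j l (j<t : toℕ j ℕ.< t) → X j l ≡ T (pivot-row j j<t) l - (C ⊗ Y) (pivot-row j j<t) l
        X-pivot j l j<t = by-cases (toℕ j <? t)
          where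
          by-cases : (d : Dec (toℕ j ℕ.< t)) → X-row j d l ≡ T (pivot-row j j<t) l - (C ⊗ Y) (pivot-row j j<t) l
          by-cases (yes j<t′) = cong (λ i → T i l - (C ⊗ Y) i l) (FinP.fromℕ<-cong _ _ refl _ _)
          by-cases (no  j≮t)  = ⊥-elim (j≮t j<t)

        X-beyond : ∀ j l → ¬ (toℕ j ℕ.< t) → X j l ≡ 0ℤ
        X-beyond j l j≮t = by-cases (toℕ j <? t)
          where
          by-cases : (d : Dec (toℕ j ℕ.< t)) → X-row j d l ≡ 0ℤ
          by-cases (yes j<t) = ⊥-elim (j≮t j<t)
          by-cases (no  _)   = refl

        DX+CY≃T-pivot : ∀ i l → toℕ i ℕ.< t → (D ⊗ X) i l + (C ⊗ Y) i l ≃ T i l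
        DX+CY≃T-pivot i l i<t = ≃-reflexive (begin
            (D ⊗ X) i l + (C ⊗ Y) i l
          ≡⟨ cong (_+ (C ⊗ Y) i l) (sumF-single a _ (toℕ i) i<a λ j j≢i →
               trans (cong (_* X j l) (Dentry-off rank exponent (toℕ i) (toℕ j) (j≢i ∘ sym))) (ℤP.*-zeroˡ (X j l))) ⟩
            D i j₀ * X j₀ l + (C ⊗ Y) i l
          ≡⟨ cong₂ (λ d x → d * x + (C ⊗ Y) i l) D-pivot≡1 X-pivot≡ ⟩
            1ℤ * (T i l - (C ⊗ Y) i l) + (C ⊗ Y) i l
          ≡⟨ cancel (T i l) ((C ⊗ Y) i l) ⟩
            T i l ∎)
          where
          open ≡-Reasoning
          i<r : toℕ i ℕ.< rank
          i<r = ℕP.<-≤-trans i<t t≤rank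
          i<a : toℕ i ℕ.< a
          i<a = ℕP.<-≤-trans i<r rank≤a
          j₀ : Fin a
          j₀ = fromℕ< i<a
          D-pivot≡1 : D i j₀ ≡ 1ℤ
          D-pivot≡1 = trans (cong (Dentry rank exponent (toℕ i)) (FinP.toℕ-fromℕ< i<a))
                      (trans (Dentry-diag rank exponent (toℕ i) i<r)
                             (cong p^_ (zero-below (fromℕ< i<r) (subst (ℕ._< t) (sym (FinP.toℕ-fromℕ< i<r)) i<t))))
          j₀<t : toℕ j₀ ℕ.< t
          j₀<t = subst (ℕ._< t) (sym (FinP.toℕ-fromℕ< i<a)) i<t
          X-pivot≡ : X j₀ l ≡ T i l - (C ⊗ Y) i l
          X-pivot≡ = trans (X-pivot j₀ l j₀<t)
            (cong (λ i′ → T i′ l - (C ⊗ Y) i′ l) (FinP.toℕ-injective (trans (FinP.toℕ-fromℕ< _) (FinP.toℕ-fromℕ< i<a))))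
          cancel : ∀ x c → 1ℤ * (x - c) + c ≡ x
          cancel = solve-∀

        DX+CY≃T-lower : ∀ i l → t ℕ.≤ toℕ i → (D ⊗ X) i l + (C ⊗ Y) i l ≃ T i l
        DX+CY≃T-lower i l t≤i = ≃-trans (+-cong (≃-reflexive DX≡0) (≃-refl {(C ⊗ Y) i l}))
          (≃-trans (≃-reflexive (trans (ℤP.+-identityˡ _) (cong (λ i″ → (C ⊗ Y) i″ l) (sym lower-i′≡i))))
          (≃-trans (CₗY≃ZeroI i′ l)
          (≃-reflexive (trans (ZeroI-δ k m′ i′ l) (trans (cong (δ (toℕ l)) shift) (sym (ZeroI-δ k m i l)))))))
          where
          DX≡0 : (D ⊗ X) i l ≡ 0ℤ
          DX≡0 = sumF-zero a λ j → by-cases j (toℕ i ℕP.≟ toℕ j)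
            where
            by-cases : ∀ j → Dec (toℕ i ≡ toℕ j) → D i j * X j l ≡ 0ℤ
            by-cases j (yes i≡j) = trans (cong (D i j *_) (X-beyond j l λ j<t → ℕP.<⇒≱ j<t (subst (t ℕ.≤_) i≡j t≤i)))
                                         (ℤP.*-zeroʳ (D i j))
            by-cases j (no  i≢j) = trans (cong (_* X j l) (Dentry-off rank exponent (toℕ i) (toℕ j) i≢j)) (ℤP.*-zeroˡ (X j l))
          i-t<m′ : toℕ i ∸ t ℕ.< m′
          i-t<m′ = ℕP.∸-monoˡ-< (FinP.toℕ<n i) t≤i
          i′ : Fin m′
          i′ = fromℕ< i-t<m′
          lower-i′≡i : lower i′ ≡ i
          lower-i′≡i = FinP.toℕ-injective (trans (toℕ-lower i′)
                         (trans (cong (t ℕ.+_) (FinP.toℕ-fromℕ< i-t<m′)) (ℕP.m+[n∸m]≡n t≤i)))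
          k-m′≡k-m+t : k ∸ m′ ≡ (k ∸ m) ℕ.+ t
          k-m′≡k-m+t = ℕP.+-cancelʳ-≡ m′ _ _ (trans (ℕP.m∸n+n≡m m′≤k) (sym (begin
              (k ∸ m) ℕ.+ t ℕ.+ m′    ≡⟨ ℕP.+-assoc (k ∸ m) t m′ ⟩
              (k ∸ m) ℕ.+ (t ℕ.+ m′)  ≡⟨ cong ((k ∸ m) ℕ.+_) (ℕP.m+[n∸m]≡n t≤m) ⟩
              (k ∸ m) ℕ.+ m           ≡⟨ ℕP.m∸n+n≡m m≤k ⟩
              k                       ∎)))
            where open ≡-Reasoning
          shift : (k ∸ m′) ℕ.+ toℕ i′ ≡ (k ∸ m) ℕ.+ toℕ i
          shift = trans (cong₂ ℕ._+_ k-m′≡k-m+t (FinP.toℕ-fromℕ< i-t<m′))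
                        (trans (ℕP.+-assoc (k ∸ m) t _) (cong ((k ∸ m) ℕ.+_) (ℕP.m+[n∸m]≡n t≤i)))

        DX⊕CY≃T : D ⊗ X ⊕ C ⊗ Y ≃ₘ T
        DX⊕CY≃T i l = [ DX+CY≃T-pivot i l , DX+CY≃T-lower i l ∘ ℕP.≮⇒≥ ]′ (Dec.toSum (toℕ i <? t))

        W₂ : Matrix (a ℕ.+ k) (a ℕ.+ k)
        W₂ = block (I a) X 𝟘 Y

        W : Matrix (a ℕ.+ k) (a ℕ.+ k)
        W = (W₁ ⊗ W₃) ⊗ W₂

        W-invertible : Invertible (a ℕ.+ k) W
        W-invertible = ⊗-invertible W₁₃-invertible (block-upper-invertible X (I-invertible a) Y-invertible)

        [D∣T]≃DI : [ D ∣ T ] ≃ₘ DI (a ℕ.+ k) m rank exponent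
        [D∣T]≃DI = ≃ₘ-sym (DI-[∣] a k m rank exponent m≤k rank≤a)

        B-normal : (L₁ ⊗ B) ⊗ W ≃ₘ DI (a ℕ.+ k) m rank exponent
        B-normal = begin
            (L₁ ⊗ B) ⊗ ((W₁ ⊗ W₃) ⊗ W₂)
          ≈⟨ ≃ₘ-sym (⊗-assoc (L₁ ⊗ B) (W₁ ⊗ W₃) W₂) ⟩
            ((L₁ ⊗ B) ⊗ (W₁ ⊗ W₃)) ⊗ W₂
          ≈⟨ ⊗-congˡ W₂ B≃[D∣C] ⟩
            [ D ∣ C ] ⊗ W₂
          ≈⟨ [∣]-⊗-block D C (I a) X 𝟘 Y ⟩
            [ D ⊗ I a ⊕ C ⊗ 𝟘 ∣ D ⊗ X ⊕ C ⊗ Y ]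
          ≈⟨ [∣]-cong (≃ₘ-trans (⊕-cong (⊗-identityʳ D) (⊗-zeroʳ C)) (⊕-identityʳ D)) DX⊕CY≃T ⟩
            [ D ∣ T ]
          ≈⟨ [D∣T]≃DI ⟩
            DI (a ℕ.+ k) m rank exponent ∎
          where open SetoidReasoning (≃ₘ-setoid m (a ℕ.+ k))

        A-normal : (inverse Y-invertible ⊗ A) ⊗ W ≃ₘ ZeroI (a ℕ.+ k) k
        A-normal = begin
            (Y⁻¹ ⊗ A) ⊗ ((W₁ ⊗ W₃) ⊗ W₂)
          ≈⟨ ⊗-assoc Y⁻¹ A W ⟩
            Y⁻¹ ⊗ (A ⊗ ((W₁ ⊗ W₃) ⊗ W₂))
          ≈⟨ ⊗-congʳ Y⁻¹ (≃ₘ-trans (≃ₘ-sym (⊗-assoc A (W₁ ⊗ W₃) W₂))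
                                   (⊗-congˡ W₂ (≃ₘ-sym (⊗-assoc A W₁ W₃)))) ⟩
            Y⁻¹ ⊗ (((A ⊗ W₁) ⊗ W₃) ⊗ W₂)
          ≈⟨ ⊗-congʳ Y⁻¹ (⊗-congˡ W₂ (⊗-congˡ W₃ (≃ₘ-trans AW₁≃ZeroI (ZeroI-[∣] a k)))) ⟩
            Y⁻¹ ⊗ (([ 𝟘 ∣ I k ] ⊗ W₃) ⊗ W₂)
          ≈⟨ ⊗-congʳ Y⁻¹ (≃ₘ-trans (⊗-congˡ W₂ ([𝟘∣I]⊗block R₁ 𝟘 𝟘 (I k))) ([𝟘∣I]⊗block (I a) X 𝟘 Y)) ⟩
            Y⁻¹ ⊗ [ 𝟘 ∣ Y ]
          ≈⟨ ⊗-congʳ Y⁻¹ (≃ₘ-sym (⊗-[𝟘∣I] Y)) ⟩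
            Y⁻¹ ⊗ (Y ⊗ [ 𝟘 ∣ I k ])
          ≈⟨ cancelˡ Y⁻¹ Y [ 𝟘 ∣ I k ] (inverseˡ Y-invertible) ⟩
            [ 𝟘 ∣ I k ]
          ≈⟨ ≃ₘ-sym (ZeroI-[∣] a k) ⟩
            ZeroI (a ℕ.+ k) k ∎
          where
          open SetoidReasoning (≃ₘ-setoid k (a ℕ.+ k))
          Y⁻¹ : Matrix k k
          Y⁻¹ = inverse Y-invertible

        U : Matrix (a ℕ.+ k) (a ℕ.+ k)
        U = inverse W-invertible

        A≐ZeroI⊗U : A ≐ (ZeroI (a ℕ.+ k) k ⊗ U)
        A≐ZeroI⊗U = equivalent⇒≐ A (ZeroI (a ℕ.+ k) k) (inverse-invertible Y-invertible) W-invertible A-normal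

        B≐DI⊗U : B ≐ (DI (a ℕ.+ k) m rank exponent ⊗ U)
        B≐DI⊗U = equivalent⇒≐ B (DI (a ℕ.+ k) m rank exponent) L₁-invertible W-invertible B-normal

        -- With rank 0, DI = (0, T) = T (0, I).
        rank≡0⇒B⊑A : rank ≡ 0 → B ⊑ A
        rank≡0⇒B⊑A rank≡0 =
          ⊑-trans (proj₁ B≐DI⊗U) (⊑-trans (factor⇒⊑ _ _ T DI⊗U≃T⊗ZeroI⊗U) (proj₂ A≐ZeroI⊗U))
          where
          D≃𝟘 : D ≃ₘ 𝟘
          D≃𝟘 i j = ≃-reflexive (Dentry-beyond rank exponent (toℕ i) (toℕ j) (subst (ℕ._≤ toℕ i) (sym rank≡0) z≤n))
          DI≃T⊗ZeroI : DI (a ℕ.+ k) m rank exponent ≃ₘ T ⊗ ZeroI (a ℕ.+ k) k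
          DI≃T⊗ZeroI = ≃ₘ-trans (≃ₘ-sym [D∣T]≃DI)
            (≃ₘ-trans ([∣]-cong D≃𝟘 ≃ₘ-refl) (≃ₘ-sym (≃ₘ-trans (⊗-congʳ T (ZeroI-[∣] a k)) (⊗-[𝟘∣I] T))))
          DI⊗U≃T⊗ZeroI⊗U : DI (a ℕ.+ k) m rank exponent ⊗ U ≃ₘ T ⊗ (ZeroI (a ℕ.+ k) k ⊗ U)
          DI⊗U≃T⊗ZeroI⊗U = ≃ₘ-trans (⊗-congˡ U DI≃T⊗ZeroI) (⊗-assoc T (ZeroI (a ℕ.+ k) k) U)

      normal-form : ∀ {n} a k m → a ℕ.+ k ≡ n → m ℕ.≤ k → (A : Matrix k n) (B : Matrix m n) →
        Unimodular A → Unimodular B → ¬ (B ⊑ A) →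
        Σ (Matrix n n) λ U → GL n U ×
          Σ ℕ λ r → 1 ℕ.≤ r × r ℕ.≤ m × r ℕ.≤ n ∸ k ×
            Σ (Fin r → ℕ) λ e →
              (∀ x y → x ≤ᶠ y → e x ℕ.≤ e y) ×
              (∀ x → e x ℕ.≤ (s ∸ 1) ⊔ 1) ×
              A ≐ (ZeroI n k ⊗ U) ×
              B ≐ (DI n m r e ⊗ U)
      normal-form a k m refl m≤k A B A-unimodular B-unimodular B⋢A =
        U , Invertible⇒GL (inverse-invertible W-invertible) ,
        rank , ℕP.n≢0⇒n>0 (B⋢A ∘ rank≡0⇒B⊑A) , rank≤m , subst (rank ℕ.≤_) (sym (ℕP.m+n∸n≡m a k)) rank≤a ,
        exponent , exponent-mono , (λ x → ℕP.≤-trans (ℕP.∸-monoˡ-≤ 1 (exponent<s x)) (ℕP.m≤m⊔n (s ∸ 1) 1)) ,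
        A≐ZeroI⊗U , B≐DI⊗U
        where open Reduction a k m m≤k A B A-unimodular B-unimodular

theorem3p1 : (p s : ℕ) → Prime p → 1 ≤ s →
    (n k m : ℕ) → k < n → m ≤ k → 1 ≤ m →
    (A : Ring.Matrix p s k n) (B : Ring.Matrix p s m n) →
    Ring.Unimodular p s A → Ring.Unimodular p s B →
    ¬ Ring._⊑_ p s B A →
    Σ (Ring.Matrix p s n n) λ U → Ring.GL p s n U ×
    Σ ℕ λ r → 1 ≤ r × r ≤ m × r ≤ n ∸ k ×
    Σ (Fin r → ℕ) λ e →
    (∀ a b → a ≤ᶠ b → e a ≤ e b) ×
    (∀ a → e a ≤ (s ∸ 1) ⊔ 1) ×
    Ring._≐_ p s A (Ring._⊗_ p s (Ring.ZeroI p s n k) U) ×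
    Ring._≐_ p s B (Ring._⊗_ p s (Ring.DI p s n m r e) U)
theorem3p1 p s p-prime 1≤s n k m k<n m≤k _ =
  NormalForm.normal-form p s p-prime 1≤s (n ∸ k) k m (ℕP.m∸n+n≡m (ℕP.<⇒≤ k<n)) m≤k
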